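{- Let $\mathbf{x}$ be the ruler sequence over $\{0,1,2,\ldots\}$ and let $\mathbf{y}=\theta(\mathbf{x})$. Then $\mathbf{y}$ is a squarefree word with $\operatorname{nsc}_{\mathbf{y}}(n)<3n$ for all $n\ge1$ except $n=2$.
   Context: The ruler sequence $\mathbf{x}=0102010301020104\cdots$ is the limit of the words $Z_0=\epsilon$, $Z_{n+1}=Z_n\,n\,Z_n$ over the infinite alphabet $\{0,1,2,\ldots\}$. Let $\mathbf{w}=abcacbabcbacabc\cdots$ be the fixed point of the morphism $a\mapsto abc$, $b\mapsto ac$, $c\mapsto b$, and for $i\ge0$ let $W_i$ be the prefix of $\mathbf{w}$ of length $i$. The morphism $\theta:\{0,1,2,\ldots\}^*\to\{a,b,c,d,e\}^*$ is defined by $\theta(i)=dW_ieW_i$. A word is squarefree if it has no nonempty factor of the form $uu$. For an infinite word $\mathbf{z}=z_0z_1z_2\cdots$ (indexed from $0$) and $n\ge1$, $\operatorname{nsc}_{\mathbf{z}}(n)=\max\{m\in\mathbb{N}: z_i\cdots z_{i+n-1}\neq z_j\cdots z_{j+n-1}\text{ for all } 0\le i<j\le m-1\}$. -}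

module Defs where

open import Data.Nat using (ℕ; zero; suc; _+_; _*_; _<_; _≤_)
open import Data.List using (List; []; _∷_; _++_; concatMap; map; upTo; [_])
open import Data.Product using (_×_)
open import Relation.Nullary using (¬_)
open import Relation.Binary.PropositionalEquality using (_≡_; _≢_)

-- Infinite words are functions ℕ → A (indexed from 0).

-- total list lookup with a default (only ever used at in-range indices below)
nth : {A : Set} → A → List A → ℕ → A
nth dflt []       _       = dflt
nth dflt (x ∷ xs) zero    = x
nth dflt (x ∷ xs) (suc i) = nth dflt xs i

prefix : {A : Set} → (ℕ → A) → ℕ → List A
prefix z n = map z (upTo n)

Z : ℕ → List ℕ
Z zero    = []
Z (suc n) = Z n ++ (n ∷ Z n)

-- |Z_{i+1}| = 2^{i+1} - 1 > i, and Z_n is a prefix of Z_{n+1}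
ruler : ℕ → ℕ
ruler i = nth 0 (Z (suc i)) i

data Letter : Set where
  a b c d e : Letter

-- morphism a ↦ abc, b ↦ ac, c ↦ b (d, e never occur in its iterates of a)
h : Letter → List Letter
h a = a ∷ b ∷ c ∷ []
h b = a ∷ c ∷ []
h c = b ∷ []
h d = d ∷ []
h e = e ∷ []

hIter : ℕ → List Letter
hIter zero    = a ∷ []
hIter (suc k) = concatMap h (hIter k)

-- fixed point w = lim h^k(a); |h^{i+1}(a)| > i
w : ℕ → Letter
w i = nth a (hIter (suc i)) i

W : ℕ → List Letter
W i = prefix w i

θ : ℕ → List Letter
θ i = d ∷ W i ++ (e ∷ W i)

-- θ applied to an infinite word; |θ(k)| ≥ 2, so the first j+1 images
-- have total length > j
θ∞ : (ℕ → ℕ) → ℕ → Letter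
θ∞ z j = nth a (concatMap θ (prefix z (suc j))) j

y : ℕ → Letter
y = θ∞ ruler

SquareFree : {A : Set} → (ℕ → A) → Set
SquareFree z = (i n : ℕ) → 1 ≤ n →
  ¬ ((k : ℕ) → k < n → z (i + k) ≡ z (i + n + k))

factor : {A : Set} → (ℕ → A) → ℕ → ℕ → List A
factor z i n = map (λ k → z (i + k)) (upTo n)

DistinctUpTo : {A : Set} → (ℕ → A) → ℕ → ℕ → Set
DistinctUpTo z n m = (i j : ℕ) → i < j → j < m → factor z i n ≢ factor z j n

IsNsc : {A : Set} → (ℕ → A) → ℕ → ℕ → Set
IsNsc z n m = DistinctUpTo z n m × ((m' : ℕ) → DistinctUpTo z n m' → m' ≤ m)

module Submission where

open import Defs
open import Data.Nat using (ℕ; zero; suc; _+_; _*_; _≤_; _<_; _≟_; _≤?_; _<?_; z≤n; s≤s; ⌊_/2⌋)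
open import Data.Nat.Properties
open import Data.Nat.Tactic.RingSolver using (solve-∀)
open import Data.Bool using (Bool; true; false; not; _xor_; _∧_)
open import Data.Bool.Properties using (not-injective; not-¬) renaming (_≟_ to _≟ᵇ_)
open import Data.List using (List; []; _∷_; _++_; [_]; concatMap; upTo; applyUpTo; length)
open import Data.List.Properties
  using (map-upTo; applyUpTo-∷ʳ; length-applyUpTo; length-map; length-++; concatMap-++; ++-assoc; ++-identityʳ)
open import Data.Product using (Σ; ∃; _×_; _,_; proj₁; proj₂)
open import Data.Sum using (_⊎_; inj₁; inj₂)
open import Data.Empty using (⊥; ⊥-elim)
open import Relation.Nullary using (¬_; yes; no)
open import Relation.Binary.PropositionalEquality hiding ([_])
open import Relation.Binary.Definitions using (tri<; tri≈; tri>)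

nth-++ˡ : {A : Set} (dflt : A) (xs ys : List A) (i : ℕ) → i < length xs →
          nth dflt (xs ++ ys) i ≡ nth dflt xs i
nth-++ˡ dflt (x ∷ xs) ys zero    _         = refl
nth-++ˡ dflt (x ∷ xs) ys (suc i) (s≤s i<n) = nth-++ˡ dflt xs ys i i<n

nth-++ʳ : {A : Set} (dflt : A) (xs ys : List A) (i : ℕ) →
          nth dflt (xs ++ ys) (length xs + i) ≡ nth dflt ys i
nth-++ʳ dflt []       ys i = refl
nth-++ʳ dflt (x ∷ xs) ys i = nth-++ʳ dflt xs ys i

nth-applyUpTo : {A : Set} (dflt : A) (f : ℕ → A) (n i : ℕ) → i < n → nth dflt (applyUpTo f n) i ≡ f i
nth-applyUpTo dflt f (suc n) zero    _         = refl
nth-applyUpTo dflt f (suc n) (suc i) (s≤s i<n) = nth-applyUpTo dflt (λ k → f (suc k)) n i i<n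

nth-prefix : {A : Set} (dflt : A) (z : ℕ → A) (n i : ℕ) → i < n → nth dflt (prefix z n) i ≡ z i
nth-prefix dflt z n i i<n = trans (cong (λ l → nth dflt l i) (map-upTo z n)) (nth-applyUpTo dflt z n i i<n)

applyUpTo-+ : {A : Set} (f : ℕ → A) (m r : ℕ) →
              applyUpTo f (m + r) ≡ applyUpTo f m ++ applyUpTo (λ k → f (m + k)) r
applyUpTo-+ f zero    r = refl
applyUpTo-+ f (suc m) r = cong (f 0 ∷_) (applyUpTo-+ (λ k → f (suc k)) m r)

applyUpTo-cong : {A : Set} {f f' : ℕ → A} (n : ℕ) → ((k : ℕ) → k < n → f k ≡ f' k) →
                 applyUpTo f n ≡ applyUpTo f' n
applyUpTo-cong zero    _  = refl
applyUpTo-cong (suc n) eq = cong₂ _∷_ (eq 0 (s≤s z≤n)) (applyUpTo-cong n (λ k k<n → eq (suc k) (s≤s k<n)))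

prefix-+ : {A : Set} (z : ℕ → A) (m r : ℕ) → prefix z (m + r) ≡ prefix z m ++ applyUpTo (λ k → z (m + k)) r
prefix-+ z m r = trans (map-upTo z (m + r)) (trans (applyUpTo-+ z m r) (cong (_++ applyUpTo (λ k → z (m + k)) r) (sym (map-upTo z m))))

prefix-suc : {A : Set} (z : ℕ → A) (j : ℕ) → prefix z (suc j) ≡ prefix z j ++ [ z j ]
prefix-suc z j =
  trans (map-upTo z (suc j)) (trans (sym (applyUpTo-∷ʳ z j)) (cong (_++ [ z j ]) (sym (map-upTo z j))))

data Parity : ℕ → Set where
  even : (q : ℕ) → Parity (q + q)
  odd  : (q : ℕ) → Parity (suc (q + q))

parity : (n : ℕ) → Parity n
parity zero = even 0
parity (suc n) with parity n
... | even q = odd q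
... | odd q  = subst Parity (cong suc (+-suc q q)) (even (suc q))

trichotomy-≡ : {m n : ℕ} → ¬ (m < n) → ¬ (n < m) → m ≡ n
trichotomy-≡ {m} {n} m≮n n≮m with <-cmp m n
... | tri< m<n _ _ = ⊥-elim (m≮n m<n)
... | tri≈ _ m≡n _ = m≡n
... | tri> _ _ n<m = ⊥-elim (n≮m n<m)

≤-by : (x z : ℕ) {u : ℕ} → u ≡ x + z → x ≤ u
≤-by x z refl = m≤m+n x z

<-by : (x z : ℕ) {u : ℕ} → u ≡ suc x + z → x < u
<-by x z refl = s≤s (m≤m+n x z)

half-≤ : {u f : ℕ} → suc u + suc u ≤ suc f → suc u ≤ f
half-≤ {u} le = ≤-trans (m≤n+m (suc u) u) (≤-pred le)

≢-≢⇒≡ : {x y z : Bool} → x ≢ y → y ≢ z → x ≡ z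
≢-≢⇒≡ {true}  {true}          x≢y _   = ⊥-elim (x≢y refl)
≢-≢⇒≡ {true}  {false} {true}  _   _   = refl
≢-≢⇒≡ {true}  {false} {false} _   y≢z = ⊥-elim (y≢z refl)
≢-≢⇒≡ {false} {true}  {true}  _   y≢z = ⊥-elim (y≢z refl)
≢-≢⇒≡ {false} {true}  {false} _   _   = refl
≢-≢⇒≡ {false} {false}         x≢y _   = ⊥-elim (x≢y refl)

no-three-distinct : {x y z : Bool} → x ≢ y → y ≢ z → z ≢ x → ⊥
no-three-distinct x≢y y≢z z≢x = z≢x (sym (≢-≢⇒≡ x≢y y≢z))

-- The Thue–Morse word t: t(2q) = t(q), t(2q+1) = ¬ t(q)

isOdd : ℕ → Bool
isOdd zero          = false
isOdd (suc zero)    = true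
isOdd (suc (suc n)) = isOdd n

isOdd-even : (q : ℕ) → isOdd (q + q) ≡ false
isOdd-even zero    = refl
isOdd-even (suc q) = trans (cong (λ n → isOdd (suc n)) (+-suc q q)) (isOdd-even q)

isOdd-odd : (q : ℕ) → isOdd (suc (q + q)) ≡ true
isOdd-odd zero    = refl
isOdd-odd (suc q) = trans (cong (λ n → isOdd (suc (suc n))) (+-suc q q)) (isOdd-odd q)

-- t computed with fuel; the fuel is irrelevant once it is at least the argument.
tmFuel : ℕ → ℕ → Bool
tmFuel _       zero    = false
tmFuel zero    (suc n) = false
tmFuel (suc f) (suc n) = isOdd (suc n) xor tmFuel f ⌊ suc n /2⌋

tmFuel-stable : (f g n : ℕ) → n ≤ f → n ≤ g → tmFuel f n ≡ tmFuel g n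
tmFuel-stable f       g       zero    _         _         = refl
tmFuel-stable (suc f) (suc g) (suc n) (s≤s n≤f) (s≤s n≤g) =
  cong (isOdd (suc n) xor_) (tmFuel-stable f g ⌊ suc n /2⌋ (≤-trans half≤n n≤f) (≤-trans half≤n n≤g))
  where
  half≤n : ⌊ suc n /2⌋ ≤ n
  half≤n = ≤-pred (⌊n/2⌋<n n)

tm : ℕ → Bool
tm n = tmFuel n n

tm-even : (q : ℕ) → tm (q + q) ≡ tm q
tm-even zero    = refl
tm-even (suc q) = begin
  isOdd (suc q + suc q) xor tmFuel (q + suc q) ⌊ suc q + suc q /2⌋
    ≡⟨ cong₂ _xor_ (isOdd-even (suc q)) (cong (tmFuel (q + suc q)) (sym (n≡⌊n+n/2⌋ (suc q)))) ⟩
  tmFuel (q + suc q) (suc q)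
    ≡⟨ tmFuel-stable (q + suc q) (suc q) (suc q) (m≤n+m (suc q) q) ≤-refl ⟩
  tm (suc q) ∎
  where open ≡-Reasoning

tm-odd : (q : ℕ) → tm (suc (q + q)) ≡ not (tm q)
tm-odd q = begin
  isOdd (suc (q + q)) xor tmFuel (q + q) ⌊ suc (q + q) /2⌋
    ≡⟨ cong₂ _xor_ (isOdd-odd q) (cong (tmFuel (q + q)) (sym (n≡⌈n+n/2⌉ q))) ⟩
  not (tmFuel (q + q) q)
    ≡⟨ cong not (tmFuel-stable (q + q) q q (m≤m+n q q) ≤-refl) ⟩
  not (tm q) ∎
  where open ≡-Reasoning

tm-pair : (q : ℕ) → tm (q + q) ≢ tm (suc (q + q))
tm-pair q eq = not-¬ refl (trans (sym (tm-even q)) (trans eq (tm-odd q)))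

-- t has no three equal consecutive letters: one of the first two pairs starts at an even position.
tm-noTriple : (p : ℕ) → tm p ≡ tm (suc p) → tm (suc p) ≡ tm (suc (suc p)) → ⊥
tm-noTriple p e₁ e₂ with parity p
... | even q = tm-pair q e₁
... | odd q  = tm-pair (suc q) (trans (cong (λ n → tm (suc n)) (+-suc q q))
                               (trans e₂ (cong (λ n → tm (suc (suc n))) (sym (+-suc q q)))))

-- An overlap of period l at i: the factor t(i) … t(i + 2l) has period l.
Overlap : ℕ → ℕ → Set
Overlap i l = (k : ℕ) → k ≤ l → tm (i + k) ≡ tm (i + l + k)

halve-overlap : (i l : ℕ) → Overlap i (l + l) → Σ ℕ λ i' → Overlap i' l
halve-overlap i l ov with parity i
... | even q = q , λ k k≤l →
  trans (sym (tm-even (q + k)))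
   (trans (cong tm (even-pos q k))
   (trans (ov (k + k) (+-mono-≤ k≤l k≤l))
   (trans (cong tm (even-shift q l k)) (tm-even (q + l + k)))))
  where
  even-pos : (q k : ℕ) → (q + k) + (q + k) ≡ q + q + (k + k)
  even-pos = solve-∀
  even-shift : (q l k : ℕ) → q + q + (l + l) + (k + k) ≡ (q + l + k) + (q + l + k)
  even-shift = solve-∀
... | odd q = q , λ k k≤l → not-injective
  (trans (sym (tm-odd (q + k)))
   (trans (cong tm (odd-pos q k))
   (trans (ov (k + k) (+-mono-≤ k≤l k≤l))
   (trans (cong tm (odd-shift q l k)) (tm-odd (q + l + k))))))
  where
  odd-pos : (q k : ℕ) → suc ((q + k) + (q + k)) ≡ suc (q + q) + (k + k)
  odd-pos = solve-∀
  odd-shift : (q l k : ℕ) → suc (q + q) + (l + l) + (k + k) ≡ suc ((q + l + k) + (q + l + k))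
  odd-shift = solve-∀

-- Inside a factor with odd period l = 2l'+1 that starts at the even position x = 2q, the
-- letters at x+2m+1 and x+2m+2 differ: they are copies of a pair starting at an even position.
oddPeriod-pair : (q l' m : ℕ) →
  tm (q + q + suc (m + m)) ≡ tm (q + q + suc (l' + l') + suc (m + m)) →
  tm (q + q + suc (suc (m + m))) ≡ tm (q + q + suc (l' + l') + suc (suc (m + m))) →
  tm (q + q + suc (m + m)) ≢ tm (q + q + suc (suc (m + m)))
oddPeriod-pair q l' m e₁ e₂ eq =
  tm-pair p (trans (cong tm (pos₁ q l' m)) (trans (sym e₁) (trans eq (trans e₂ (cong tm (pos₂ q l' m))))))
  where
  p : ℕ
  p = q + l' + suc m
  pos₁ : (q l' m : ℕ) → (q + l' + suc m) + (q + l' + suc m) ≡ q + q + suc (l' + l') + suc (m + m)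
  pos₁ = solve-∀
  pos₂ : (q l' m : ℕ) → q + q + suc (l' + l') + suc (suc (m + m)) ≡ suc ((q + l' + suc m) + (q + l' + suc m))
  pos₂ = solve-∀

evenOffset-pair : (q m : ℕ) → tm (q + q + (m + m)) ≢ tm (q + q + suc (m + m))
evenOffset-pair q m eq =
  tm-pair (q + m) (trans (cong tm (pos₁ q m)) (trans eq (cong tm (pos₂ q m))))
  where
  pos₁ : (q m : ℕ) → (q + m) + (q + m) ≡ q + q + (m + m)
  pos₁ = solve-∀
  pos₂ : (q m : ℕ) → q + q + suc (m + m) ≡ suc ((q + m) + (q + m))
  pos₂ = solve-∀

evenNear : (i : ℕ) → Σ ℕ λ δ → Σ ℕ λ q → δ ≤ 1 × i + δ ≡ q + q
evenNear i with parity i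
... | even q = 0 , q , z≤n , +-identityʳ (q + q)
... | odd q  = 1 , suc q , s≤s z≤n , trans (+-comm (suc (q + q)) 1) (cong suc (sym (+-suc q q)))

module OddOverlap (i l' : ℕ) (ov : Overlap i (suc (l' + l'))) where
  l δ q : ℕ
  l = suc (l' + l')
  δ = proj₁ (evenNear i)
  q = proj₁ (proj₂ (evenNear i))

  δ≤1 : δ ≤ 1
  δ≤1 = proj₁ (proj₂ (proj₂ (evenNear i)))

  i+δ≡x : i + δ ≡ q + q
  i+δ≡x = proj₂ (proj₂ (proj₂ (evenNear i)))

  periodic : (j : ℕ) → suc j ≤ l → tm (q + q + j) ≡ tm (q + q + l + j)
  periodic j j<l = begin
    tm (q + q + j)       ≡⟨ cong (λ x → tm (x + j)) (sym i+δ≡x) ⟩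
    tm (i + δ + j)       ≡⟨ cong tm (+-assoc i δ j) ⟩
    tm (i + (δ + j))     ≡⟨ ov (δ + j) (≤-trans (+-monoˡ-≤ j δ≤1) j<l) ⟩
    tm (i + l + (δ + j)) ≡⟨ cong tm (shift i l δ j) ⟩
    tm (i + δ + l + j)   ≡⟨ cong (λ x → tm (x + l + j)) i+δ≡x ⟩
    tm (q + q + l + j)   ∎
    where
    open ≡-Reasoning
    shift : (i l δ j : ℕ) → i + l + (δ + j) ≡ i + δ + l + j
    shift = solve-∀

-- Overlaps of odd period are impossible: from the even position x the letters alternate
-- (period 3 would force three pairwise distinct letters, period ≥ 5 gives
-- t(q) = t(q+1) = t(q+2) after halving).
oddOverlap-impossible : (i l' : ℕ) → ¬ Overlap i (suc (l' + l'))
oddOverlap-impossible i zero ov =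
  tm-noTriple i (trans (cong tm (sym (+-identityʳ i))) (trans (ov 0 z≤n) (cong tm (i+1+0 i))))
                (trans (cong tm (+-comm 1 i)) (trans (ov 1 (s≤s z≤n)) (cong tm (i+1+1 i))))
  where
  i+1+0 : (i : ℕ) → i + 1 + 0 ≡ suc i
  i+1+0 = solve-∀
  i+1+1 : (i : ℕ) → i + 1 + 1 ≡ suc (suc i)
  i+1+1 = solve-∀
oddOverlap-impossible i (suc zero) ov = no-three-distinct x₀≢x₁ x₁≢x₂ x₂≢x₀
  where
  open OddOverlap i 1 ov
  x₀≢x₁ : tm (q + q + 0) ≢ tm (q + q + 1)
  x₀≢x₁ = evenOffset-pair q 0
  x₁≢x₂ : tm (q + q + 1) ≢ tm (q + q + 2)
  x₁≢x₂ = oddPeriod-pair q 1 0 (periodic 1 (s≤s (s≤s z≤n))) (periodic 2 ≤-refl)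
  x₂≢x₀ : tm (q + q + 2) ≢ tm (q + q + 0)
  x₂≢x₀ eq = evenOffset-pair q 1 (trans eq (trans (periodic 0 (s≤s z≤n)) (cong tm (+-identityʳ (q + q + 3)))))
oddOverlap-impossible i (suc (suc l'')) ov = tm-noTriple q
  (trans (sym (tm-even q)) (trans (cong tm (sym (+-identityʳ (q + q)))) (trans x₀≡x₂ (trans (cong tm (two q)) (tm-even (suc q))))))
  (trans (sym (tm-even (suc q))) (trans (cong tm (sym (two q))) (trans x₂≡x₄ (trans (cong tm (four q)) (tm-even (suc (suc q)))))))
  where
  open OddOverlap i (suc (suc l'')) ov
  five≤l : 5 ≤ l
  five≤l = s≤s (s≤s (s≤s (≤-trans (s≤s (s≤s z≤n)) (m≤n+m (suc (suc l'')) l''))))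
  below : (j : ℕ) → j ≤ 4 → suc j ≤ l
  below j j≤4 = ≤-trans (s≤s j≤4) five≤l
  x₀≡x₂ : tm (q + q + 0) ≡ tm (q + q + 2)
  x₀≡x₂ = ≢-≢⇒≡ (evenOffset-pair q 0)
    (oddPeriod-pair q (suc (suc l'')) 0 (periodic 1 (below 1 (s≤s z≤n))) (periodic 2 (below 2 (s≤s (s≤s z≤n)))))
  x₂≡x₄ : tm (q + q + 2) ≡ tm (q + q + 4)
  x₂≡x₄ = ≢-≢⇒≡ (evenOffset-pair q 1)
    (oddPeriod-pair q (suc (suc l'')) 1 (periodic 3 (below 3 (s≤s (s≤s (s≤s z≤n))))) (periodic 4 (below 4 ≤-refl)))
  two : (q : ℕ) → q + q + 2 ≡ suc q + suc q
  two = solve-∀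
  four : (q : ℕ) → q + q + 4 ≡ suc (suc q) + suc (suc q)
  four = solve-∀

-- t is overlap-free (strong induction on the period, with fuel f ≥ l).
overlapFree : (f i l : ℕ) → l ≤ f → 1 ≤ l → ¬ Overlap i l
overlapFree f i l l≤f 1≤l ov with parity l
overlapFree f       i .(zero + zero)       l≤f     () ov | even zero
overlapFree (suc f) i .(suc l' + suc l')   l≤f     _  ov | even (suc l') with halve-overlap i (suc l') ov
... | i' , ov' = overlapFree f i' (suc l') (half-≤ l≤f) (s≤s z≤n) ov'
overlapFree f       i .(suc (l' + l'))     _       _  ov | odd l' = oddOverlap-impossible i l' ov

tm-overlapFree : (i l : ℕ) → 1 ≤ l → ¬ Overlap i l
tm-overlapFree i l = overlapFree l i l ≤-refl

-- The word v(n) = code(t(n), t(n+1)) and its squarefreeness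

code : Bool → Bool → Letter
code false true  = a
code true  false = c
code false false = b
code true  true  = b

v : ℕ → Letter
v n = code (tm n) (tm (suc n))

code-sameFirst : {x x' y' : Bool} → code x x' ≡ code x y' → x' ≡ y'
code-sameFirst {false} {false} {false} _  = refl
code-sameFirst {false} {true}  {true}  _  = refl
code-sameFirst {true}  {false} {false} _  = refl
code-sameFirst {true}  {true}  {true}  _  = refl
code-sameFirst {false} {false} {true}  ()
code-sameFirst {false} {true}  {false} ()
code-sameFirst {true}  {false} {true}  ()
code-sameFirst {true}  {true}  {false} ()

code-diffFirst : {x x' y y' : Bool} → code x x' ≡ code y y' → x ≢ y → x ≡ x' × y ≡ y'
code-diffFirst {false} {false} {true}  {true}  _  _   = refl , refl
code-diffFirst {true}  {true}  {false} {false} _  _   = refl , refl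
code-diffFirst {false} {_}     {false} {_}     _  x≢y = ⊥-elim (x≢y refl)
code-diffFirst {true}  {_}     {true}  {_}     _  x≢y = ⊥-elim (x≢y refl)
code-diffFirst {false} {true}  {true}  {true}  ()
code-diffFirst {false} {true}  {true}  {false} ()
code-diffFirst {false} {false} {true}  {false} ()
code-diffFirst {true}  {false} {false} {false} ()
code-diffFirst {true}  {false} {false} {true}  ()
code-diffFirst {true}  {true}  {false} {true}  ()

-- A square uu in v: if t agrees at the starts of both halves, the square lifts to an overlap
-- of t; otherwise every letter of the square is b, making t constant on both halves.
v-squarefree : SquareFree v
v-squarefree i n 1≤n sq with tm i ≟ᵇ tm (i + n)
... | yes same = tm-overlapFree i n 1≤n lifted
  where
  lifted : Overlap i n
  lifted zero    _   = trans (cong tm (+-identityʳ i)) (trans same (cong tm (sym (+-identityʳ (i + n)))))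
  lifted (suc k) k<n =
    trans (cong tm (+-suc i k))
      (trans (code-sameFirst (trans (sq k k<n) (cong (λ x → code x (tm (suc (i + n + k)))) (sym (lifted k (<⇒≤ k<n))))))
             (cong tm (sym (+-suc (i + n) k))))
... | no differ = differ (sym (proj₁ (constant n ≤-refl)))
  where
  constant : (k : ℕ) → k ≤ n → tm (i + k) ≡ tm i × tm (i + n + k) ≡ tm (i + n)
  constant zero    _   = cong tm (+-identityʳ i) , cong tm (+-identityʳ (i + n))
  constant (suc k) k<n with constant k (<⇒≤ k<n)
  ... | left , right with code-diffFirst (sq k k<n) (λ eq → differ (trans (sym left) (trans eq right)))
  ... | step₁ , step₂ = trans (cong tm (+-suc i k)) (trans (sym step₁) left)
                      , trans (cong tm (+-suc (i + n) k)) (trans (sym step₂) right)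

-- w = v: h maps the prefix of v of length L to its prefix of length 2L + t(L)

bit : Bool → ℕ
bit false = 0
bit true  = 1

imageLength : ℕ → ℕ
imageLength L = L + L + bit (tm L)

-- The image h(code p q) is spelled by the three codes around an even position 2L with
-- t(L) = p, t(L+1) = q, starting at 2L + bit p.
h-block : (p q : Bool) (u : ℕ → Letter) →
          u 0 ≡ code p (not p) → u 1 ≡ code (not p) q → u 2 ≡ code q (not q) →
          applyUpTo (λ k → u (bit p + k)) (length (h (code p q))) ≡ h (code p q)
h-block false true  u e₀ e₁ e₂ = cong₂ _∷_ e₀ (cong₂ _∷_ e₁ (cong₂ _∷_ e₂ refl))
h-block false false u e₀ e₁ e₂ = cong₂ _∷_ e₀ (cong₂ _∷_ e₁ refl)
h-block true  true  u e₀ e₁ e₂ = cong₂ _∷_ e₁ (cong₂ _∷_ e₂ refl)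
h-block true  false u e₀ e₁ e₂ = cong₂ _∷_ e₁ refl

-- … and ends where the image of the next letter starts.
h-block-length : (p q : Bool) → bit p + length (h (code p q)) ≡ 2 + bit q
h-block-length false true  = refl
h-block-length false false = refl
h-block-length true  true  = refl
h-block-length true  false = refl

imageLength-step : (L : ℕ) → imageLength (suc L) ≡ imageLength L + length (h (v L))
imageLength-step L = begin
  suc L + suc L + bit (tm (suc L))                        ≡⟨ shift L (bit (tm (suc L))) ⟩
  L + L + (2 + bit (tm (suc L)))                          ≡⟨ cong (L + L +_) (sym (h-block-length (tm L) (tm (suc L)))) ⟩
  L + L + (bit (tm L) + length (h (v L)))                 ≡⟨ sym (+-assoc (L + L) (bit (tm L)) _) ⟩
  imageLength L + length (h (v L))                        ∎
  where
  open ≡-Reasoning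
  shift : (L b : ℕ) → suc L + suc L + b ≡ L + L + (2 + b)
  shift = solve-∀

v-block : (L : ℕ) → applyUpTo (λ k → v (imageLength L + k)) (length (h (v L))) ≡ h (v L)
v-block L = trans (applyUpTo-cong _ (λ k _ → cong v (+-assoc (L + L) (bit (tm L)) k)))
                  (h-block (tm L) (tm (suc L)) (λ k → v (L + L + k)) v₀ v₁ v₂)
  where
  v₀ : v (L + L + 0) ≡ code (tm L) (not (tm L))
  v₀ = cong₂ code (trans (cong tm (+-identityʳ (L + L))) (tm-even L))
                  (trans (cong (λ x → tm (suc x)) (+-identityʳ (L + L))) (tm-odd L))
  v₁ : v (L + L + 1) ≡ code (not (tm L)) (tm (suc L))
  v₁ = cong₂ code (trans (cong tm (+-comm (L + L) 1)) (tm-odd L))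
                  (trans (cong tm (two L)) (tm-even (suc L)))
    where
    two : (L : ℕ) → suc (L + L + 1) ≡ suc L + suc L
    two = solve-∀
  v₂ : v (L + L + 2) ≡ code (tm (suc L)) (not (tm (suc L)))
  v₂ = cong₂ code (trans (cong tm (two L)) (tm-even (suc L)))
                  (trans (cong tm (three L)) (tm-odd (suc L)))
    where
    two : (L : ℕ) → L + L + 2 ≡ suc L + suc L
    two = solve-∀
    three : (L : ℕ) → suc (L + L + 2) ≡ suc (suc L + suc L)
    three = solve-∀

h-prefix-v : (L : ℕ) → concatMap h (prefix v L) ≡ prefix v (imageLength L)
h-prefix-v zero    = refl
h-prefix-v (suc L) = begin
  concatMap h (prefix v (suc L))                   ≡⟨ cong (concatMap h) (prefix-suc v L) ⟩
  concatMap h (prefix v L ++ [ v L ])              ≡⟨ concatMap-++ h (prefix v L) [ v L ] ⟩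
  concatMap h (prefix v L) ++ concatMap h [ v L ]  ≡⟨ cong₂ _++_ (h-prefix-v L) (++-identityʳ (h (v L))) ⟩
  prefix v (imageLength L) ++ h (v L)              ≡⟨ cong (prefix v (imageLength L) ++_) (sym (v-block L)) ⟩
  prefix v (imageLength L) ++ applyUpTo (λ k → v (imageLength L + k)) (length (h (v L)))
                                                   ≡⟨ sym (prefix-+ v (imageLength L) _) ⟩
  prefix v (imageLength L + length (h (v L)))      ≡⟨ cong (prefix v) (sym (imageLength-step L)) ⟩
  prefix v (imageLength (suc L))                   ∎
  where open ≡-Reasoning

iterLength : ℕ → ℕ
iterLength zero    = 1
iterLength (suc k) = imageLength (iterLength k)

hIter≡prefix : (k : ℕ) → hIter k ≡ prefix v (iterLength k)
hIter≡prefix zero    = refl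
hIter≡prefix (suc k) = trans (cong (concatMap h) (hIter≡prefix k)) (h-prefix-v (iterLength k))

iterLength-grows : (k : ℕ) → suc k ≤ iterLength k
iterLength-grows zero    = ≤-refl
iterLength-grows (suc k) =
  ≤-trans (s≤s (m≤n+m (suc k) k)) (≤-trans (+-mono-≤ (iterLength-grows k) (iterLength-grows k)) (m≤m+n _ _))

w≡v : (i : ℕ) → w i ≡ v i
w≡v i = trans (cong (λ l → nth a l i) (hIter≡prefix (suc i)))
              (nth-prefix a v (iterLength (suc i)) i (≤-trans (n≤1+n (suc i)) (iterLength-grows (suc i))))

w-squarefree : SquareFree w
w-squarefree i n 1≤n sq = v-squarefree i n 1≤n (λ k k<n → trans (sym (w≡v (i + k))) (trans (sq k k<n) (w≡v (i + n + k))))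

w≢d : (t : ℕ) → w t ≢ d
w≢d t eq = code≢d (tm t) (tm (suc t)) (trans (sym (w≡v t)) eq)
  where
  code≢d : (x x' : Bool) → code x x' ≢ d
  code≢d false true  ()
  code≢d true  false ()
  code≢d false false ()
  code≢d true  true  ()

w≢e : (t : ℕ) → w t ≢ e
w≢e t eq = code≢e (tm t) (tm (suc t)) (trans (sym (w≡v t)) eq)
  where
  code≢e : (x x' : Bool) → code x x' ≢ e
  code≢e false true  ()
  code≢e true  false ()
  code≢e false false ()
  code≢e true  true  ()

-- The ruler word x

Square : {A : Set} → (ℕ → A) → ℕ → ℕ → Set
Square z i r = (k : ℕ) → k < r → z (i + k) ≡ z (i + r + k)

spread : List ℕ → List ℕ
spread []      = []
spread (n ∷ l) = 0 ∷ suc n ∷ spread l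

spread-++ : (l l' : List ℕ) → spread (l ++ l') ≡ spread l ++ spread l'
spread-++ []      l' = refl
spread-++ (n ∷ l) l' = cong (λ s → 0 ∷ suc n ∷ s) (spread-++ l l')

Z-spread : (k : ℕ) → Z (suc k) ≡ spread (Z k) ++ [ 0 ]
Z-spread zero    = refl
Z-spread (suc k) = begin
  Z (suc k) ++ suc k ∷ Z (suc k)                         ≡⟨ cong₂ (λ u u' → u ++ suc k ∷ u') (Z-spread k) (Z-spread k) ⟩
  (spread (Z k) ++ [ 0 ]) ++ suc k ∷ spread (Z k) ++ [ 0 ] ≡⟨ ++-assoc (spread (Z k)) [ 0 ] _ ⟩
  spread (Z k) ++ 0 ∷ suc k ∷ spread (Z k) ++ [ 0 ]       ≡⟨ sym (++-assoc (spread (Z k)) (0 ∷ suc k ∷ spread (Z k)) [ 0 ]) ⟩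
  (spread (Z k) ++ spread (k ∷ Z k)) ++ [ 0 ]             ≡⟨ cong (_++ [ 0 ]) (sym (spread-++ (Z k) (k ∷ Z k))) ⟩
  spread (Z k ++ k ∷ Z k) ++ [ 0 ]                       ∎
  where open ≡-Reasoning

nth-spread-even : (l : List ℕ) (q : ℕ) → nth 0 (spread l ++ [ 0 ]) (q + q) ≡ 0
nth-spread-even []      zero    = refl
nth-spread-even []      (suc q) = refl
nth-spread-even (n ∷ l) zero    = refl
nth-spread-even (n ∷ l) (suc q) rewrite +-suc q q = nth-spread-even l q

nth-spread-odd : (l : List ℕ) (q : ℕ) → q < length l → nth 0 (spread l ++ [ 0 ]) (suc (q + q)) ≡ suc (nth 0 l q)
nth-spread-odd (n ∷ l) zero    _         = refl
nth-spread-odd (n ∷ l) (suc q) (s≤s q<l) rewrite +-suc q q = nth-spread-odd l q q<l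

lenZ : ℕ → ℕ
lenZ k = length (Z k)

lenZ-suc : (k : ℕ) → lenZ (suc k) ≡ lenZ k + suc (lenZ k)
lenZ-suc k = length-++ (Z k)

lenZ-step : (k : ℕ) → suc (lenZ k) ≤ lenZ (suc k)
lenZ-step k = ≤-by (suc (lenZ k)) (lenZ k) (trans (lenZ-suc k) (+-comm (lenZ k) _))

lenZ-grows : (k : ℕ) → k ≤ lenZ k
lenZ-grows zero    = z≤n
lenZ-grows (suc k) = ≤-trans (s≤s (lenZ-grows k)) (lenZ-step k)

Z-extends : (k o : ℕ) → Σ (List ℕ) λ rest → Z (k + o) ≡ Z k ++ rest
Z-extends k zero    = [] , trans (cong Z (+-identityʳ k)) (sym (++-identityʳ (Z k)))
Z-extends k (suc o) with Z-extends k o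
... | rest , Zk+o≡ = rest ++ (k + o) ∷ Z (k + o) , (begin
  Z (k + suc o)                     ≡⟨ cong Z (+-suc k o) ⟩
  Z (k + o) ++ (k + o) ∷ Z (k + o)  ≡⟨ cong (_++ (k + o) ∷ Z (k + o)) Zk+o≡ ⟩
  (Z k ++ rest) ++ (k + o) ∷ Z (k + o) ≡⟨ ++-assoc (Z k) rest _ ⟩
  Z k ++ rest ++ (k + o) ∷ Z (k + o) ∎)
  where open ≡-Reasoning

Z-agree : {k k' : ℕ} (i : ℕ) → k ≤ k' → i < lenZ k → nth 0 (Z k') i ≡ nth 0 (Z k) i
Z-agree {k} i k≤k' i<l with m≤n⇒∃[o]m+o≡n k≤k'
... | o , refl with Z-extends k o
... | rest , eq = trans (cong (λ l → nth 0 l i) eq) (nth-++ˡ 0 (Z k) rest i i<l)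

ruler-Z : (k i : ℕ) → i < lenZ k → ruler i ≡ nth 0 (Z k) i
ruler-Z k i i<l with ≤-total k (suc i)
... | inj₁ k≤ = Z-agree i k≤ i<l
... | inj₂ ≤k = sym (Z-agree i ≤k (≤-trans (s≤s (lenZ-grows i)) (lenZ-step i)))

ruler-even : (q : ℕ) → ruler (q + q) ≡ 0
ruler-even q = trans (cong (λ l → nth 0 l (q + q)) (Z-spread (q + q))) (nth-spread-even (Z (q + q)) q)

ruler-odd : (q : ℕ) → ruler (suc (q + q)) ≡ suc (ruler q)
ruler-odd q = trans (cong (λ l → nth 0 l (suc (q + q))) (Z-spread (suc (q + q))))
  (trans (nth-spread-odd (Z (suc (q + q))) q q<l) (cong suc (sym (ruler-Z (suc (q + q)) q q<l))))
  where
  q<l : q < lenZ (suc (q + q))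
  q<l = ≤-trans (s≤s (m≤m+n q q)) (lenZ-grows (suc (q + q)))

-- A square of even period 2r in x restricts, on the positions of one parity, to a square of
-- period r (odd positions carry x(q) + 1; even-started squares use the odd positions).
halve-rulerSquare : (i r : ℕ) → Square ruler i (suc r + suc r) → Σ ℕ λ i' → Square ruler i' (suc r)
halve-rulerSquare i r sq with parity i
... | even q = q , λ k k<r → suc-injective (begin
  suc (ruler (q + k))                          ≡⟨ sym (ruler-odd (q + k)) ⟩
  ruler (suc ((q + k) + (q + k)))              ≡⟨ cong ruler (pos q k) ⟩
  ruler (q + q + suc (k + k))                  ≡⟨ sq (suc (k + k)) (odd< k<r) ⟩
  ruler (q + q + (suc r + suc r) + suc (k + k)) ≡⟨ cong ruler (pos' q r k) ⟩
  ruler (suc ((q + suc r + k) + (q + suc r + k))) ≡⟨ ruler-odd (q + suc r + k) ⟩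
  suc (ruler (q + suc r + k))                  ∎)
  where
  open ≡-Reasoning
  pos : (q k : ℕ) → suc ((q + k) + (q + k)) ≡ q + q + suc (k + k)
  pos = solve-∀
  pos' : (q r k : ℕ) → q + q + (suc r + suc r) + suc (k + k) ≡ suc ((q + suc r + k) + (q + suc r + k))
  pos' = solve-∀
  odd< : {k : ℕ} → k < suc r → suc (k + k) < suc r + suc r
  odd< (s≤s k≤r) = s≤s (≤-trans (s≤s (+-mono-≤ k≤r k≤r)) (≤-reflexive (sym (+-suc r r))))
... | odd q = q , λ k k<r → suc-injective (begin
  suc (ruler (q + k))                          ≡⟨ sym (ruler-odd (q + k)) ⟩
  ruler (suc ((q + k) + (q + k)))              ≡⟨ cong ruler (pos q k) ⟩
  ruler (suc (q + q) + (k + k))                ≡⟨ sq (k + k) (even< k<r) ⟩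
  ruler (suc (q + q) + (suc r + suc r) + (k + k)) ≡⟨ cong ruler (pos' q r k) ⟩
  ruler (suc ((q + suc r + k) + (q + suc r + k))) ≡⟨ ruler-odd (q + suc r + k) ⟩
  suc (ruler (q + suc r + k))                  ∎)
  where
  open ≡-Reasoning
  pos : (q k : ℕ) → suc ((q + k) + (q + k)) ≡ suc (q + q) + (k + k)
  pos = solve-∀
  pos' : (q r k : ℕ) → suc (q + q) + (suc r + suc r) + (k + k) ≡ suc ((q + suc r + k) + (q + suc r + k))
  pos' = solve-∀
  even< : {k : ℕ} → k < suc r → k + k < suc r + suc r
  even< (s≤s k≤r) = s≤s (+-mono-≤ k≤r (m≤n⇒m≤1+n k≤r))

-- A square of odd period compares x at positions of different parity: one value is 0, the
-- other a successor.
oddRulerSquare-impossible : (i r : ℕ) → ¬ Square ruler i (suc (r + r))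
oddRulerSquare-impossible i r sq with parity i
... | even q = 0≢1+n (begin
  0                                ≡⟨ sym (ruler-even q) ⟩
  ruler (q + q)                    ≡⟨ cong ruler (sym (+-identityʳ (q + q))) ⟩
  ruler (q + q + 0)                ≡⟨ sq 0 (s≤s z≤n) ⟩
  ruler (q + q + suc (r + r) + 0)  ≡⟨ cong ruler (pos q r) ⟩
  ruler (suc ((q + r) + (q + r)))  ≡⟨ ruler-odd (q + r) ⟩
  suc (ruler (q + r))              ∎)
  where
  open ≡-Reasoning
  pos : (q r : ℕ) → q + q + suc (r + r) + 0 ≡ suc ((q + r) + (q + r))
  pos = solve-∀
... | odd q = 0≢1+n (begin
  0                                   ≡⟨ sym (ruler-even (suc (q + r))) ⟩
  ruler (suc (q + r) + suc (q + r))   ≡⟨ cong ruler (pos q r) ⟩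
  ruler (suc (q + q) + suc (r + r) + 0) ≡⟨ sym (sq 0 (s≤s z≤n)) ⟩
  ruler (suc (q + q) + 0)             ≡⟨ cong ruler (+-identityʳ (suc (q + q))) ⟩
  ruler (suc (q + q))                 ≡⟨ ruler-odd q ⟩
  suc (ruler q)                       ∎)
  where
  open ≡-Reasoning
  pos : (q r : ℕ) → suc (q + r) + suc (q + r) ≡ suc (q + q) + suc (r + r) + 0
  pos = solve-∀

-- x is squarefree (strong induction on the period, with fuel f ≥ r).
rulerSquareFree : (f i r : ℕ) → r ≤ f → 1 ≤ r → ¬ Square ruler i r
rulerSquareFree f i r r≤f 1≤r sq with parity r
rulerSquareFree f       i .(zero + zero)     _   () sq | even zero
rulerSquareFree (suc f) i .(suc r + suc r)   r≤f _  sq | even (suc r) with halve-rulerSquare i r sq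
... | i' , sq' = rulerSquareFree f i' (suc r) (half-≤ r≤f) (s≤s z≤n) sq'
rulerSquareFree f       i .(suc (r + r))     _   _  sq | odd r = oddRulerSquare-impossible i r sq

ruler-squarefree : SquareFree ruler
ruler-squarefree i r = rulerSquareFree r i r ≤-refl

Z-below : (K i : ℕ) → i < lenZ K → nth 0 (Z K) i < K
Z-below (suc K) i i<l with i <? lenZ K
... | yes i<l' = m<n⇒m<1+n (subst (_< K) (sym (nth-++ˡ 0 (Z K) (K ∷ Z K) i i<l')) (Z-below K i i<l'))
... | no i≮l' with m≤n⇒∃[o]m+o≡n (≮⇒≥ i≮l')
...   | zero  , refl = ≤-reflexive (cong suc (nth-++ʳ 0 (Z K) (K ∷ Z K) 0))
...   | suc o , refl = m<n⇒m<1+n (subst (_< K) (sym (nth-++ʳ 0 (Z K) (K ∷ Z K) (suc o))) (Z-below K o o<l))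
  where
  o<l : o < lenZ K
  o<l = ≤-pred (+-cancelˡ-< (lenZ K) (suc o) (suc (lenZ K)) (≤-trans i<l (≤-reflexive (lenZ-suc K))))

ruler-lenZ : (K : ℕ) → ruler (lenZ K) ≡ K
ruler-lenZ K = trans (ruler-Z (suc K) (lenZ K) (lenZ-step K))
                     (trans (cong (nth 0 (Z K ++ K ∷ Z K)) (sym (+-identityʳ _))) (nth-++ʳ 0 (Z K) (K ∷ Z K) 0))

ruler-shift : (K u : ℕ) → u < lenZ K → ruler (lenZ K + suc u) ≡ ruler u
ruler-shift K u u<l =
  trans (ruler-Z (suc K) (lenZ K + suc u) (≤-trans (+-monoʳ-< (lenZ K) (s≤s u<l)) (≤-reflexive (sym (lenZ-suc K)))))
        (trans (nth-++ʳ 0 (Z K) (K ∷ Z K) (suc u)) (sym (ruler-Z K u u<l)))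

ruler-below : (K u : ℕ) → u < lenZ K → ruler u < K
ruler-below K u u<l = subst (_< K) (sym (ruler-Z K u u<l)) (Z-below K u u<l)

ruler-large-unique : (K p : ℕ) → p < lenZ (suc K) → K ≤ ruler p → p ≡ lenZ K
ruler-large-unique K p p<l K≤x with <-cmp p (lenZ K)
... | tri≈ _ p≡ _ = p≡
... | tri< p<  _ _ = ⊥-elim (<⇒≱ (ruler-below K p p<) K≤x)
... | tri> _ _ p>  with m≤n⇒∃[o]m+o≡n p>
...   | o , refl = ⊥-elim (<⇒≱ (subst (_< K) (sym x≡) (ruler-below K o o<l)) K≤x)
  where
  o<l : o < lenZ K
  o<l = ≤-pred (+-cancelˡ-< (lenZ K) (suc o) (suc (lenZ K))
          (≤-trans (≤-reflexive (cong suc (+-suc (lenZ K) o))) (≤-trans p<l (≤-reflexive (lenZ-suc K)))))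
  x≡ : ruler (suc (lenZ K + o)) ≡ ruler o
  x≡ = trans (cong ruler (sym (+-suc (lenZ K) o))) (ruler-shift K o o<l)

-- The block structure of y = θ(x(0)) θ(x(1)) ⋯

θlen : ℕ → ℕ
θlen u = suc (suc (u + u))

length-W : (u : ℕ) → length (W u) ≡ u
length-W u = trans (length-map w (upTo u)) (length-applyUpTo (λ k → k) u)

length-θ : (u : ℕ) → length (θ u) ≡ θlen u
length-θ u = cong suc (trans (length-++ (W u)) (trans (cong₂ _+_ (length-W u) (cong suc (length-W u))) (+-suc u u)))

-- P j is the position where block j starts. Only the recursion P (j+1) = P j + |θ(x j)| and
-- the fact that block j of y is θ(x j) are used, so the definitions are kept opaque.
opaque
  blocks : ℕ → List Letter
  blocks N = concatMap θ (prefix ruler N)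

  P : ℕ → ℕ
  P j = length (blocks j)

  P-zero : P 0 ≡ 0
  P-zero = refl

  blocks-suc : (j : ℕ) → blocks (suc j) ≡ blocks j ++ θ (ruler j)
  blocks-suc j = trans (cong (concatMap θ) (prefix-suc ruler j))
                   (trans (concatMap-++ θ (prefix ruler j) [ ruler j ]) (cong (blocks j ++_) (++-identityʳ (θ (ruler j)))))

  P-suc : (j : ℕ) → P (suc j) ≡ P j + θlen (ruler j)
  P-suc j = trans (cong length (blocks-suc j)) (trans (length-++ (blocks j)) (cong (P j +_) (length-θ (ruler j))))

  blocks-split : (j o : ℕ) → Σ (List Letter) λ rest → blocks (j + suc o) ≡ blocks j ++ θ (ruler j) ++ rest
  blocks-split j o = concatMap θ (applyUpTo (λ k → ruler (j + suc k)) o) ,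
    trans (cong (concatMap θ) (trans (prefix-+ ruler j (suc o)) (cong (λ n → prefix ruler j ++ ruler n ∷ applyUpTo (λ k → ruler (j + suc k)) o) (+-identityʳ j))))
          (concatMap-++ θ (prefix ruler j) _)

  P-grows : (j : ℕ) → j + j ≤ P j
  P-grows zero    = z≤n
  P-grows (suc j) = ≤-trans (≤-reflexive (two j)) (≤-trans (+-monoˡ-≤ 2 (P-grows j))
                      (≤-trans (+-monoʳ-≤ (P j) (s≤s (s≤s z≤n))) (≤-reflexive (sym (P-suc j)))))
    where
    two : (j : ℕ) → suc j + suc j ≡ j + j + 2
    two = solve-∀

  y-block : (j t : ℕ) → t < θlen (ruler j) → y (P j + t) ≡ nth a (θ (ruler j)) t
  y-block j t t< with m≤n⇒∃[o]m+o≡n (≤-trans (m≤m+n j j) (≤-trans (P-grows j) (m≤m+n (P j) t)))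
  ... | o , j+o≡ with blocks-split j o
  ... | rest , split = begin
    nth a (blocks (suc (P j + t))) (P j + t)     ≡⟨ cong (λ N → nth a (blocks N) (P j + t)) (trans (cong suc (sym j+o≡)) (sym (+-suc j o))) ⟩
    nth a (blocks (j + suc o)) (P j + t)         ≡⟨ cong (λ l → nth a l (P j + t)) split ⟩
    nth a (blocks j ++ θ (ruler j) ++ rest) (P j + t) ≡⟨ nth-++ʳ a (blocks j) _ t ⟩
    nth a (θ (ruler j) ++ rest) t                ≡⟨ nth-++ˡ a (θ (ruler j)) rest t (≤-trans t< (≤-reflexive (sym (length-θ (ruler j))))) ⟩
    nth a (θ (ruler j)) t                        ∎
    where open ≡-Reasoning

θ-W₁ : (u t : ℕ) → t < u → nth a (θ u) (suc t) ≡ w t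
θ-W₁ u t t<u = trans (nth-++ˡ a (W u) _ t (≤-trans t<u (≤-reflexive (sym (length-W u))))) (nth-prefix a w u t t<u)

θ-e : (u : ℕ) → nth a (θ u) (suc u) ≡ e
θ-e u = trans (cong (nth a (W u ++ e ∷ W u)) (trans (sym (length-W u)) (sym (+-identityʳ _)))) (nth-++ʳ a (W u) (e ∷ W u) 0)

θ-W₂ : (u t : ℕ) → t < u → nth a (θ u) (suc (suc (u + t))) ≡ w t
θ-W₂ u t t<u = trans (cong (nth a (W u ++ e ∷ W u)) (trans (cong (λ n → suc (n + t)) (sym (length-W u))) (sym (+-suc _ t))))
                     (trans (nth-++ʳ a (W u) (e ∷ W u) (suc t)) (nth-prefix a w u t t<u))

-- E j is the position of the e of block j.
E : ℕ → ℕ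
E j = P j + suc (ruler j)

P-suc-E : (j : ℕ) → P (suc j) ≡ E j + suc (ruler j)
P-suc-E j = trans (P-suc j) (trans (cong (P j +_) (split (ruler j))) (sym (+-assoc (P j) _ _)))
  where
  split : (u : ℕ) → suc (suc (u + u)) ≡ suc u + suc u
  split = solve-∀

y-P : (j : ℕ) → y (P j) ≡ d
y-P j = trans (cong y (sym (+-identityʳ (P j)))) (y-block j 0 (s≤s z≤n))

y-E : (j : ℕ) → y (E j) ≡ e
y-E j = trans (y-block j (suc (ruler j)) (s≤s (s≤s (m≤m+n _ _)))) (θ-e (ruler j))

y-W₁ : (j t : ℕ) → t < ruler j → y (P j + suc t) ≡ w t
y-W₁ j t t<u = trans (y-block j (suc t) (s≤s (≤-trans t<u (≤-trans (m≤m+n _ _) (n≤1+n _))))) (θ-W₁ (ruler j) t t<u)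

y-W₂ : (j t : ℕ) → t < ruler j → y (E j + suc t) ≡ w t
y-W₂ j t t<u = trans (cong y (shift (P j) (ruler j) t))
  (trans (y-block j (suc (suc (ruler j + t))) (s≤s (s≤s (≤-trans (≤-reflexive (sym (+-suc (ruler j) t))) (+-monoʳ-≤ (ruler j) t<u)))))
         (θ-W₂ (ruler j) t t<u))
  where
  shift : (p u t : ℕ) → p + suc u + suc t ≡ p + suc (suc (u + t))
  shift = solve-∀

P<E : (j : ℕ) → P j < E j
P<E j = m<m+n (P j) (s≤s z≤n)

E<P-suc : (j : ℕ) → E j < P (suc j)
E<P-suc j = subst (E j <_) (sym (P-suc-E j)) (m<m+n (E j) (s≤s z≤n))

P<P-suc : (j : ℕ) → P j < P (suc j)
P<P-suc j = <-trans (P<E j) (E<P-suc j)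

P-mono : {j j' : ℕ} → j ≤ j' → P j ≤ P j'
P-mono {j} j≤j' with m≤n⇒∃[o]m+o≡n j≤j'
... | o , refl = go o
  where
  go : (o : ℕ) → P j ≤ P (j + o)
  go zero    = ≤-reflexive (cong P (sym (+-identityʳ j)))
  go (suc o) = ≤-trans (go o) (≤-trans (<⇒≤ (P<P-suc (j + o))) (≤-reflexive (cong P (sym (+-suc j o)))))

P-mono-< : {j j' : ℕ} → j < j' → P j < P j'
P-mono-< {j} j<j' = <-≤-trans (P<P-suc j) (P-mono j<j')

E-before : {j j' : ℕ} → j < j' → E j < P j'
E-before {j} j<j' = <-≤-trans (E<P-suc j) (P-mono j<j')

E-mono : {j j' : ℕ} → j ≤ j' → E j ≤ E j'
E-mono {j} {j'} j≤j' with m≤n⇒∃[o]m+o≡n j≤j'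
... | zero  , eq = ≤-reflexive (cong E (trans (sym (+-identityʳ j)) eq))
... | suc o , eq = <⇒≤ (<-trans (E-before (≤-by (suc j) o (trans (sym eq) (+-suc j o)))) (P<E j'))

P-reflect-< : {j j' : ℕ} → P j < P j' → j < j'
P-reflect-< {j} {j'} Pj<Pj' with j <? j'
... | yes j<j' = j<j'
... | no  j≮j' = ⊥-elim (<⇒≱ Pj<Pj' (P-mono (≮⇒≥ j≮j')))

locate : (p : ℕ) → Σ ℕ λ j → Σ ℕ λ t → t < θlen (ruler j) × p ≡ P j + t
locate zero = 0 , 0 , s≤s z≤n , sym (trans (+-identityʳ _) P-zero)
locate (suc p) with locate p
... | j , t , t< , p≡ with suc t <? θlen (ruler j)
... | yes t+1< = j , suc t , t+1< , trans (cong suc p≡) (sym (+-suc (P j) t))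
... | no  t+1≮ = suc j , 0 , s≤s z≤n ,
  trans (cong suc p≡) (trans (sym (+-suc (P j) t))
    (trans (cong (P j +_) (≤-antisym t< (≮⇒≥ t+1≮))) (trans (sym (P-suc j)) (sym (+-identityʳ _)))))

d-position : (p : ℕ) → y p ≡ d → Σ ℕ λ j → p ≡ P j
d-position p yp≡d with locate p
... | j , zero  , _  , p≡ = j , trans p≡ (+-identityʳ (P j))
... | j , suc t , t< , p≡ = ⊥-elim (inside (ruler j) t t< (trans (sym (y-block j (suc t) t<)) (trans (cong y (sym p≡)) yp≡d)))
  where
  inside : (u t : ℕ) → suc t < θlen u → nth a (θ u) (suc t) ≢ d
  inside u t t< eq with t <? u
  ... | yes t<u = w≢d t (trans (sym (θ-W₁ u t t<u)) eq)
  ... | no  t≮u with t ≟ u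
  ...   | yes refl = e≢d (trans (sym (θ-e u)) eq)
    where
    e≢d : e ≢ d
    e≢d ()
  ...   | no t≢u with m≤n⇒∃[o]m+o≡n (≤∧≢⇒< (≮⇒≥ t≮u) (≢-sym t≢u))
  ...     | o , refl = w≢d o (trans (sym (θ-W₂ u o (+-cancelˡ-< u o u (≤-pred (≤-pred t<))))) eq)

e-position : (p : ℕ) → y p ≡ e → Σ ℕ λ j → p ≡ E j
e-position p yp≡e with locate p
... | j , zero  , t< , p≡ = ⊥-elim (d≢e (trans (sym (y-block j 0 t<)) (trans (cong y (sym p≡)) yp≡e)))
  where
  d≢e : d ≢ e
  d≢e ()
... | j , suc t , t< , p≡ with t <? ruler j
... | yes t<u = ⊥-elim (w≢e t (trans (sym (θ-W₁ (ruler j) t t<u)) (trans (sym (y-block j (suc t) t<)) (trans (cong y (sym p≡)) yp≡e))))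
... | no  t≮u with t ≟ ruler j
...   | yes refl = j , p≡
...   | no t≢u with m≤n⇒∃[o]m+o≡n (≤∧≢⇒< (≮⇒≥ t≮u) (≢-sym t≢u))
...     | o , refl = ⊥-elim (w≢e o (trans (sym (θ-W₂ (ruler j) o o<u)) (trans (sym (y-block j _ t<)) (trans (cong y (sym p≡)) yp≡e))))
  where
  o<u : o < ruler j
  o<u = +-cancelˡ-< (ruler j) o (ruler j) (≤-pred (≤-pred t<))

no-d-inside : (j p : ℕ) → P j < p → p < P (suc j) → y p ≢ d
no-d-inside j p Pj<p p<P yp≡d with d-position p yp≡d
... | j' , refl = <⇒≱ p<P (P-mono (P-reflect-< Pj<p))

e-inside : (j p : ℕ) → P j ≤ p → p < P (suc j) → y p ≡ e → p ≡ E j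
e-inside j p Pj≤p p<P yp≡e with e-position p yp≡e
... | j' , refl with <-cmp j j'
... | tri≈ _ refl _ = refl
... | tri< j<j' _ _ = ⊥-elim (<⇒≱ p<P (≤-trans (P-mono j<j') (<⇒≤ (P<E j'))))
... | tri> _ _ j'<j = ⊥-elim (<⇒≱ (<-≤-trans (E<P-suc j') (P-mono j'<j)) Pj≤p)

-- Two blocks whose starts agree up to the e of the first have the same length: the e of the
-- shorter one would face a letter of w in the longer one.
same-block-length : (j j' : ℕ) → ((u : ℕ) → u ≤ suc (ruler j) → y (P j + u) ≡ y (P j' + u)) → ruler j ≡ ruler j'
same-block-length j j' agree with <-cmp (ruler j) (ruler j')
... | tri≈ _ eq _ = eq
... | tri< lt _ _ = ⊥-elim (w≢e (ruler j) (trans (sym (y-W₁ j' (ruler j) lt)) (trans (sym (agree (suc (ruler j)) ≤-refl)) (y-E j))))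
... | tri> _ _ gt = ⊥-elim (w≢e (ruler j') (trans (sym (y-W₁ j (ruler j') gt)) (trans (agree (suc (ruler j')) (<⇒≤ (s≤s gt))) (y-E j'))))

y-W₁-range : (j t : ℕ) → P j + suc t < E j → y (P j + suc t) ≡ w t
y-W₁-range j t before-e = y-W₁ j t (≤-pred (+-cancelˡ-< (P j) (suc t) (suc (ruler j)) before-e))

y-W₂-range : (j t : ℕ) → E j + suc t < P (suc j) → y (E j + suc t) ≡ w t
y-W₂-range j t before-d =
  y-W₂ j t (≤-pred (+-cancelˡ-< (E j) (suc t) (suc (ruler j)) (subst (E j + suc t <_) (P-suc-E j) before-d)))

data NextStart (i : ℕ) : Set where
  at-start : (j : ℕ) → P j ≡ i → NextStart i
  inside   : (j t : ℕ) → i ≡ P j + suc t → i < P (suc j) → NextStart i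

nextStart : (i : ℕ) → NextStart i
nextStart i with locate i
... | j , zero  , _ , i≡ = at-start j (sym (trans i≡ (+-identityʳ (P j))))
... | j , suc t , t< , i≡ = inside j t i≡ (subst₂ _<_ (sym i≡) (sym (P-suc j)) (+-monoʳ-< (P j) t<))

-- y is squarefree

module SquareInY (i n : ℕ) (1≤n : 1 ≤ n) (sq : Square y i n) where

  copy : (p : ℕ) → i ≤ p → p < i + n → y p ≡ y (p + n)
  copy p i≤p p<i+n with m≤n⇒∃[o]m+o≡n i≤p
  ... | k , refl = trans (sq k (+-cancelˡ-< i k n p<i+n)) (cong y (swap i n k))
    where
    swap : (i n k : ℕ) → i + n + k ≡ i + k + n
    swap = solve-∀

  d-copied : (o : ℕ) → o < n → y (i + n + o) ≡ d → y (i + o) ≡ d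
  d-copied o o<n eq = trans (copy (i + o) (m≤m+n i o) (+-monoʳ-< i o<n)) (trans (cong y (swap i o n)) eq)
    where
    swap : (i o n : ℕ) → i + o + n ≡ i + n + o
    swap = solve-∀

  within-square : {k : ℕ} → k < n + n → i + k < i + n + n
  within-square {k} k<2n = subst (i + k <_) (sym (+-assoc i n n)) (+-monoʳ-< i k<2n)

  w-run : (t₀ : ℕ) → ((k : ℕ) → k < n + n → y (i + k) ≡ w (t₀ + k)) → ⊥
  w-run t₀ spelled = w-squarefree t₀ n 1≤n λ k k<n → begin
    w (t₀ + k)       ≡⟨ sym (spelled k (<-≤-trans k<n (m≤m+n n n))) ⟩
    y (i + k)        ≡⟨ sq k k<n ⟩
    y (i + n + k)    ≡⟨ cong y (+-assoc i n k) ⟩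
    y (i + (n + k))  ≡⟨ spelled (n + k) (+-monoʳ-< n k<n) ⟩
    w (t₀ + (n + k)) ≡⟨ cong w (sym (+-assoc t₀ n k)) ⟩
    w (t₀ + n + k)   ∎
    where open ≡-Reasoning

  -- Case 1: i lies strictly inside block j and the first half contains no block start.
  -- Then the whole square lies inside block j, where only one e occurs.
  module WithinBlock (j t : ℕ) (i≡ : i ≡ P j + suc t) (short : i + n ≤ P (suc j)) where

    no-d : (p : ℕ) → i ≤ p → p < P (suc j) → y p ≢ d
    no-d p i≤p p<P = no-d-inside j p (<-≤-trans (subst (P j <_) (sym i≡) (m<m+n (P j) (s≤s z≤n))) i≤p) p<P

    fits : i + n + n ≤ P (suc j)
    fits with i + n + n ≤? P (suc j)
    ... | yes ok = ok
    ... | no too-long with m≤n⇒∃[o]m+o≡n short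
    ...   | o , i+n+o≡P = ⊥-elim (no-d (i + o) (m≤m+n i o) (<-≤-trans (+-monoʳ-< i o<n) short)
                                   (d-copied o o<n (trans (cong y i+n+o≡P) (y-P (suc j)))))
      where
      o<n : o < n
      o<n = +-cancelˡ-< (i + n) o n (subst (_< i + n + n) (sym i+n+o≡P) (≰⇒> too-long))

    -- The square lies inside the second copy of W.
    after-e : E j < i → ⊥
    after-e E<i with m≤n⇒∃[o]m+o≡n E<i
    ... | t₁ , E+1+t₁≡i = w-run t₁ λ k k<2n → trans (cong y (pos k)) (y-W₂-range j (t₁ + k) (subst (_< P (suc j)) (pos k) (<-≤-trans (within-square k<2n) fits)))
      where
      pos : (k : ℕ) → i + k ≡ E j + suc (t₁ + k)
      pos k = trans (cong (_+ k) (sym E+1+t₁≡i)) (trans (+-assoc (suc (E j)) t₁ k) (sym (+-suc (E j) (t₁ + k))))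

    -- The e of block j cannot be in the first half: its copy would be a second e.
    e-in-first-half : i ≤ E j → E j < i + n → ⊥
    e-in-first-half i≤E E<i+n = <⇒≢ (m<m+n (E j) 1≤n) (sym (e-inside j (E j + n)
      (≤-trans (<⇒≤ (P<E j)) (m≤m+n (E j) n)) (<-≤-trans (+-monoˡ-< n E<i+n) fits)
      (trans (sym (copy (E j) i≤E E<i+n)) (y-E j))))

    -- Nor in the second half: it would be the copy of another e of block j.
    e-in-second-half : i + n ≤ E j → E j < i + n + n → ⊥
    e-in-second-half i+n≤E E<2n with m≤n⇒∃[o]m+o≡n i+n≤E
    ... | o , i+n+o≡E = <⇒≢ (m<m+n (i + o) 1≤n) (trans (e-inside j (i + o) P≤i+o i+o<P y-i+o) (trans (sym i+n+o≡E) (swap i n o)))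
      where
      o<n : o < n
      o<n = +-cancelˡ-< (i + n) o n (subst (_< i + n + n) (sym i+n+o≡E) E<2n)
      swap : (i n o : ℕ) → i + n + o ≡ i + o + n
      swap = solve-∀
      P≤i+o : P j ≤ i + o
      P≤i+o = ≤-trans (≤-trans (m≤m+n (P j) (suc t)) (≤-reflexive (sym i≡))) (m≤m+n i o)
      i+o<P : i + o < P (suc j)
      i+o<P = <-≤-trans (+-monoʳ-< i o<n) short
      y-i+o : y (i + o) ≡ e
      y-i+o = trans (copy (i + o) (m≤m+n i o) (+-monoʳ-< i o<n)) (trans (cong y (trans (+-comm-out i o n) i+n+o≡E)) (y-E j))
        where
        +-comm-out : (i o n : ℕ) → i + o + n ≡ i + n + o
        +-comm-out = solve-∀

    -- The square lies inside the first copy of W.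
    before-e : i + n + n ≤ E j → ⊥
    before-e 2n≤E = w-run t λ k k<2n → trans (cong y (pos k)) (y-W₁-range j (t + k) (subst (_< E j) (pos k) (<-≤-trans (within-square k<2n) 2n≤E)))
      where
      pos : (k : ℕ) → i + k ≡ P j + suc (t + k)
      pos k = trans (cong (_+ k) i≡) (sym (+-suc-assoc (P j) t k))
        where
        +-suc-assoc : (p t k : ℕ) → p + suc (t + k) ≡ p + suc t + k
        +-suc-assoc = solve-∀

    impossible : ⊥
    impossible with E j <? i
    ... | yes E<i = after-e E<i
    ... | no  E≮i with E j <? i + n
    ...   | yes E<i+n = e-in-first-half (≮⇒≥ E≮i) E<i+n
    ...   | no  E≮i+n with E j <? i + n + n
    ...     | yes E<2n = e-in-second-half (≮⇒≥ E≮i+n) E<2n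
    ...     | no  E≮2n = before-e (≮⇒≥ E≮2n)

  d-target : (j₁ : ℕ) → i ≤ P j₁ → P j₁ < i + n → Σ ℕ λ r' → P (j₁ + suc r') ≡ P j₁ + n
  d-target j₁ i≤P P<i+n with d-position (P j₁ + n) (trans (sym (copy (P j₁) i≤P P<i+n)) (y-P j₁))
  ... | target , P+n≡P with m≤n⇒∃[o]m+o≡n (P-reflect-< (subst (P j₁ <_) P+n≡P (m<m+n (P j₁) 1≤n)))
  ...   | r' , j₁+1+r'≡target = r' , trans (cong P (trans (+-suc j₁ r') j₁+1+r'≡target)) (sym P+n≡P)

  -- Case 2: block j₁ starts in the first half, no d lies between i and P j₁, and the d of
  -- block j₁ is copied to block j₁ + r. The blocks starting in the first half are copied onto
  -- the blocks r further on, which gives a square of period r in x.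
  module AlignedBlocks (j₁ : ℕ) (i≤P : i ≤ P j₁) (P<i+n : P j₁ < i + n)
                       (no-d : (p : ℕ) → i ≤ p → p < P j₁ → y p ≢ d)
                       (r' : ℕ) (P-target : P (j₁ + suc r') ≡ P j₁ + n) where

    r jr : ℕ
    r  = suc r'
    -- the last block starting before P j₁ + n
    jr = j₁ + r'

    P-after-jr : P (suc jr) ≡ P j₁ + n
    P-after-jr = trans (cong P (sym (+-suc j₁ r'))) P-target

    same-length : (m : ℕ) → P (j₁ + m + r) ≡ P (j₁ + m) + n → E (j₁ + m) < i + n → ruler (j₁ + m + r) ≡ ruler (j₁ + m)
    same-length m shifted E<i+n = sym (same-block-length (j₁ + m) (j₁ + m + r) λ u u≤ →
      trans (copy (P (j₁ + m) + u) (≤-trans i≤P (≤-trans (P-mono (m≤m+n j₁ m)) (m≤m+n _ u)))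
                  (≤-<-trans (+-monoʳ-≤ (P (j₁ + m)) u≤) E<i+n))
            (cong y (trans (swap (P (j₁ + m)) u n) (cong (_+ u) (sym shifted)))))
      where
      swap : (p u n : ℕ) → p + u + n ≡ p + n + u
      swap = solve-∀

    shifted : (m : ℕ) → P (j₁ + m) < i + n → P (j₁ + m + r) ≡ P (j₁ + m) + n
    shifted zero    _ = trans (cong (λ k → P (k + r)) (+-identityʳ j₁)) (trans P-target (cong (λ k → P k + n) (sym (+-identityʳ j₁))))
    shifted (suc m) P<i+n' = begin
      P (j₁ + suc m + r)                              ≡⟨ cong P (+-suc-out j₁ m r) ⟩
      P (suc (j₁ + m + r))                            ≡⟨ P-suc (j₁ + m + r) ⟩
      P (j₁ + m + r) + θlen (ruler (j₁ + m + r))      ≡⟨ cong₂ (λ p u → p + θlen u) previous (same-length m previous E<i+n) ⟩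
      P (j₁ + m) + n + θlen (ruler (j₁ + m))          ≡⟨ swap (P (j₁ + m)) n _ ⟩
      P (j₁ + m) + θlen (ruler (j₁ + m)) + n          ≡⟨ cong (_+ n) (sym (P-suc (j₁ + m))) ⟩
      P (suc (j₁ + m)) + n                            ≡⟨ cong (λ k → P k + n) (sym (+-suc j₁ m)) ⟩
      P (j₁ + suc m) + n                              ∎
      where
      open ≡-Reasoning
      +-suc-out : (j m r : ℕ) → j + suc m + r ≡ suc (j + m + r)
      +-suc-out = solve-∀
      swap : (p n u : ℕ) → p + n + u ≡ p + u + n
      swap = solve-∀
      E<i+n : E (j₁ + m) < i + n
      E<i+n = <-trans (E<P-suc (j₁ + m)) (subst (_< i + n) (cong P (+-suc j₁ m)) P<i+n')
      previous : P (j₁ + m + r) ≡ P (j₁ + m) + n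
      previous = shifted m (<-trans (P<E (j₁ + m)) E<i+n)

    -- Block jr starts in the first half: otherwise its d would copy a d lying before P j₁.
    jr-starts-early : P jr < i + n
    jr-starts-early with P jr <? i + n
    ... | yes early = early
    ... | no  late with m≤n⇒∃[o]m+o≡n (≮⇒≥ late)
    ...   | o , i+n+o≡P = ⊥-elim (no-d (i + o) (m≤m+n i o) i+o<P (d-copied o o<n (trans (cong y i+n+o≡P) (y-P jr))))
      where
      swap : (i o n : ℕ) → i + o + n ≡ i + n + o
      swap = solve-∀
      i+o<P : i + o < P j₁
      i+o<P = +-cancelʳ-< n (i + o) (P j₁)
                (subst₂ _<_ (sym (trans (swap i o n) i+n+o≡P)) P-after-jr (P<P-suc jr))
      o<n : o < n
      o<n = +-cancelˡ-< i o n (<-trans i+o<P P<i+n)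

    E-early : (k : ℕ) → k < r' → E (j₁ + k) < i + n
    E-early k k<r' = <-trans (E-before (+-monoʳ-< j₁ k<r')) jr-starts-early

    -- If block jr also ends in the first half, then x(j₁ + k) = x(j₁ + r + k) for k < r.
    aligned : E jr < i + n → ⊥
    aligned E<i+n = ruler-squarefree j₁ r (s≤s z≤n) λ k k<r →
      trans (sym (same-length k (shifted k (<-trans (P<E (j₁ + k)) (E<i+n' k k<r))) (E<i+n' k k<r))) (cong ruler (swap j₁ k r))
      where
      E<i+n' : (k : ℕ) → k < r → E (j₁ + k) < i + n
      E<i+n' k k<r = ≤-<-trans (E-mono (+-monoʳ-≤ j₁ (≤-pred k<r))) E<i+n
      swap : (j k r : ℕ) → j + k + r ≡ j + r + k
      swap = solve-∀

    e-before : ¬ (E jr < i + n) → Σ ℕ λ q → q + n ≡ E jr × i ≤ q × q < P j₁ × y q ≡ e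
    e-before E≮i+n with m≤n⇒∃[o]m+o≡n (≮⇒≥ E≮i+n)
    ... | o , i+n+o≡E = i + o , q+n≡E , m≤m+n i o , q<P
                      , trans (copy (i + o) (m≤m+n i o) (<-trans q<P P<i+n)) (trans (cong y q+n≡E) (y-E jr))
      where
      swap : (i o n : ℕ) → i + o + n ≡ i + n + o
      swap = solve-∀
      q+n≡E : i + o + n ≡ E jr
      q+n≡E = trans (swap i o n) i+n+o≡E
      q<P : i + o < P j₁
      q<P = +-cancelʳ-< n (i + o) (P j₁) (subst₂ _<_ (sym q+n≡E) P-after-jr (E<P-suc jr))

    impossible-at-start : P j₁ ≡ i → ⊥
    impossible-at-start P≡i with E jr <? i + n
    ... | yes E<i+n = aligned E<i+n
    ... | no  E≮i+n with e-before E≮i+n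
    ...   | q , _ , i≤q , q<P , _ = <⇒≱ q<P (≤-trans (≤-reflexive P≡i) i≤q)

    -- If the square starts inside block j₀ = j₁ - 1, then q is the e of block j₀, the blocks j₀
    -- and jr have equal length, and x(j₀ + k) = x(j₀ + r + k) for k < r.
    impossible-after : (j₀ : ℕ) → j₁ ≡ suc j₀ → P j₀ ≤ i → ⊥
    impossible-after j₀ j₁≡ P≤i with E jr <? i + n
    ... | yes E<i+n = aligned E<i+n
    ... | no  E≮i+n with e-before E≮i+n
    ...   | q , q+n≡E , i≤q , q<P , y-q = ruler-squarefree j₀ r (s≤s z≤n) square
      where
      q≡E : q ≡ E j₀
      q≡E = e-inside j₀ q (≤-trans P≤i i≤q) (subst (λ k → q < P k) j₁≡ q<P) y-q
      lengths : E j₀ + n + suc (ruler jr) ≡ E j₀ + n + suc (ruler j₀)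
      lengths = begin
        E j₀ + n + suc (ruler jr)        ≡⟨ cong (λ p → p + n + suc (ruler jr)) (sym q≡E) ⟩
        q + n + suc (ruler jr)           ≡⟨ cong (_+ suc (ruler jr)) q+n≡E ⟩
        E jr + suc (ruler jr)            ≡⟨ sym (P-suc-E jr) ⟩
        P (suc jr)                       ≡⟨ P-after-jr ⟩
        P j₁ + n                         ≡⟨ cong (λ k → P k + n) j₁≡ ⟩
        P (suc j₀) + n                   ≡⟨ cong (_+ n) (P-suc-E j₀) ⟩
        E j₀ + suc (ruler j₀) + n        ≡⟨ swap (E j₀) _ n ⟩
        E j₀ + n + suc (ruler j₀)        ∎
        where
        open ≡-Reasoning
        swap : (p u n : ℕ) → p + u + n ≡ p + n + u
        swap = solve-∀
      jr≡ : jr ≡ j₀ + r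
      jr≡ = trans (cong (_+ r') j₁≡) (sym (+-suc j₀ r'))
      square : Square ruler j₀ r
      square zero    _ = trans (cong ruler (+-identityʳ j₀))
                           (trans (sym (suc-injective (+-cancelˡ-≡ (E j₀ + n) _ _ lengths)))
                                  (cong ruler (trans jr≡ (sym (+-identityʳ _)))))
      square (suc k) (s≤s k<r') = begin
        ruler (j₀ + suc k)   ≡⟨ cong ruler (trans (+-suc j₀ k) (cong (_+ k) (sym j₁≡))) ⟩
        ruler (j₁ + k)       ≡⟨ sym (same-length k (shifted k (<-trans (P<E (j₁ + k)) (E-early k k<r'))) (E-early k k<r')) ⟩
        ruler (j₁ + k + r)   ≡⟨ cong ruler (trans (cong (λ j → j + k + r) j₁≡) (swap j₀ k r)) ⟩
        ruler (j₀ + r + suc k) ∎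
        where
        open ≡-Reasoning
        swap : (j k r : ℕ) → suc j + k + r ≡ j + r + suc k
        swap = solve-∀

  from-start : (j : ℕ) → P j ≡ i → ⊥
  from-start j P≡i = copied (d-target j i≤P P<i+n)
    where
    i≤P : i ≤ P j
    i≤P = ≤-reflexive (sym P≡i)
    P<i+n : P j < i + n
    P<i+n = subst (_< i + n) (sym P≡i) (m<m+n i 1≤n)
    copied : (Σ ℕ λ r' → P (j + suc r') ≡ P j + n) → ⊥
    copied (r' , P-target) = AlignedBlocks.impossible-at-start j i≤P P<i+n
      (λ p i≤p p<P _ → <⇒≱ p<P (≤-trans (≤-reflexive P≡i) i≤p)) r' P-target P≡i

  from-inside : (j t : ℕ) → i ≡ P j + suc t → i < P (suc j) → ⊥
  from-inside j t i≡ i<P with P (suc j) <? i + n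
  ... | no  P≮i+n = WithinBlock.impossible j t i≡ (≮⇒≥ P≮i+n)
  ... | yes P<i+n = copied (d-target (suc j) (<⇒≤ i<P) P<i+n)
    where
    P<i : P j < i
    P<i = subst (P j <_) (sym i≡) (m<m+n (P j) (s≤s z≤n))
    copied : (Σ ℕ λ r' → P (suc j + suc r') ≡ P (suc j) + n) → ⊥
    copied (r' , P-target) = AlignedBlocks.impossible-after (suc j) (<⇒≤ i<P) P<i+n
      (λ p i≤p p<P → no-d-inside j p (<-≤-trans P<i i≤p) p<P) r' P-target j refl (<⇒≤ P<i)

  impossible : ⊥
  impossible with nextStart i
  ... | at-start j P≡i       = from-start j P≡i
  ... | inside j t i≡ i<P    = from-inside j t i≡ i<P

y-squarefree : SquareFree y
y-squarefree i n 1≤n sq = SquareInY.impossible i n 1≤n sq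

-- Self-similarity of y: the blocks of Z_{K+1} = Z_K K Z_K

P-shift : (K u : ℕ) → u ≤ lenZ K → P (lenZ K + suc u) ≡ P (suc (lenZ K)) + P u
P-shift K zero    _ = trans (cong P (+-comm (lenZ K) 1)) (sym (trans (cong (P (suc (lenZ K)) +_) P-zero) (+-identityʳ _)))
P-shift K (suc u) u<l = begin
  P (lenZ K + suc (suc u))                               ≡⟨ cong P (+-suc (lenZ K) (suc u)) ⟩
  P (suc (lenZ K + suc u))                               ≡⟨ P-suc _ ⟩
  P (lenZ K + suc u) + θlen (ruler (lenZ K + suc u))     ≡⟨ cong₂ (λ p x → p + θlen x) (P-shift K u (<⇒≤ u<l)) (ruler-shift K u u<l) ⟩
  P (suc (lenZ K)) + P u + θlen (ruler u)                ≡⟨ +-assoc (P (suc (lenZ K))) _ _ ⟩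
  P (suc (lenZ K)) + (P u + θlen (ruler u))              ≡⟨ cong (P (suc (lenZ K)) +_) (sym (P-suc u)) ⟩
  P (suc (lenZ K)) + P (suc u)                           ∎
  where open ≡-Reasoning

-- LY K = |θ(Z_K)| and M K = |θ(Z_K K)|.
LY : ℕ → ℕ
LY K = P (lenZ K)

M : ℕ → ℕ
M K = P (suc (lenZ K))

M≡ : (K : ℕ) → M K ≡ LY K + θlen K
M≡ K = trans (P-suc (lenZ K)) (cong (λ x → LY K + θlen x) (ruler-lenZ K))

LY-suc : (K : ℕ) → LY (suc K) ≡ M K + LY K
LY-suc K = trans (cong P (lenZ-suc K)) (P-shift K (lenZ K) ≤-refl)

LY-grows : (K : ℕ) → K + K ≤ LY K
LY-grows K = ≤-trans (+-mono-≤ (lenZ-grows K) (lenZ-grows K)) (P-grows (lenZ K))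

-- The prefix of y of length LY k + k + 1 (that is θ(Z_k) d W_k) reappears at position M k.
y-repeats : (k q : ℕ) → q < LY k + suc k → y (M k + q) ≡ y q
y-repeats k q q< with q <? LY k
... | yes q<LY with locate q
...   | u , t , t< , refl = begin
  y (M k + (P u + t))                    ≡⟨ cong y (trans (sym (+-assoc (M k) (P u) t)) (cong (_+ t) (sym (P-shift k u (<⇒≤ u<l))))) ⟩
  y (P (lenZ k + suc u) + t)             ≡⟨ y-block (lenZ k + suc u) t (subst (λ x → t < θlen x) (sym (ruler-shift k u u<l)) t<) ⟩
  nth a (θ (ruler (lenZ k + suc u))) t   ≡⟨ cong (λ x → nth a (θ x) t) (ruler-shift k u u<l) ⟩
  nth a (θ (ruler u)) t                  ≡⟨ sym (y-block u t t<) ⟩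
  y (P u + t)                            ∎
  where
  open ≡-Reasoning
  u<l : u < lenZ k
  u<l = P-reflect-< (≤-<-trans (m≤m+n (P u) t) q<LY)
y-repeats k q q< | no q≮LY with m≤n⇒∃[o]m+o≡n (≮⇒≥ q≮LY)
... | zero  , refl = begin
  y (M k + (LY k + 0))    ≡⟨ cong y (trans (cong (M k +_) (+-identityʳ _)) (sym (LY-suc k))) ⟩
  y (LY (suc k))          ≡⟨ trans (y-P (lenZ (suc k))) (sym (y-P (lenZ k))) ⟩
  y (LY k)                ≡⟨ cong y (sym (+-identityʳ (LY k))) ⟩
  y (LY k + 0)            ∎
  where open ≡-Reasoning
... | suc t , refl = begin
  y (M k + (LY k + suc t))   ≡⟨ cong y (trans (sym (+-assoc (M k) (LY k) (suc t))) (cong (_+ suc t) (sym (LY-suc k)))) ⟩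
  y (LY (suc k) + suc t)     ≡⟨ y-W₁ (lenZ (suc k)) t (subst (t <_) (sym (ruler-lenZ (suc k))) (m<n⇒m<1+n t<k)) ⟩
  w t                        ≡⟨ sym (y-W₁ (lenZ k) t (subst (t <_) (sym (ruler-lenZ k)) t<k)) ⟩
  y (LY k + suc t)           ∎
  where
  open ≡-Reasoning
  t<k : t < k
  t<k = ≤-pred (+-cancelˡ-< (LY k) (suc t) (suc k) q<)

factor≡applyUpTo : {A : Set} (z : ℕ → A) (i n : ℕ) → factor z i n ≡ applyUpTo (λ k → z (i + k)) n
factor≡applyUpTo z i n = map-upTo (λ k → z (i + k)) n

factor-ext : {A : Set} (z : ℕ → A) (i j n : ℕ) → ((q : ℕ) → q < n → z (i + q) ≡ z (j + q)) → factor z i n ≡ factor z j n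
factor-ext z i j n agree = trans (factor≡applyUpTo z i n) (trans (applyUpTo-cong n agree) (sym (factor≡applyUpTo z j n)))

factor-pointwise : {A : Set} (z : ℕ → A) (i j n : ℕ) → factor z i n ≡ factor z j n → (q : ℕ) → q < n → z (i + q) ≡ z (j + q)
factor-pointwise z i j n eq q q<n = begin
  z (i + q)                                     ≡⟨ sym (nth-applyUpTo (z 0) (λ k → z (i + k)) n q q<n) ⟩
  nth (z 0) (applyUpTo (λ k → z (i + k)) n) q   ≡⟨ cong (λ l → nth (z 0) l q) (trans (sym (factor≡applyUpTo z i n)) (trans eq (factor≡applyUpTo z j n))) ⟩
  nth (z 0) (applyUpTo (λ k → z (j + k)) n) q   ≡⟨ nth-applyUpTo (z 0) (λ k → z (j + k)) n q q<n ⟩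
  z (j + q)                                     ∎
  where open ≡-Reasoning

distinct-longer : {A : Set} (z : ℕ → A) (t n m : ℕ) → t ≤ n → DistinctUpTo z t m → DistinctUpTo z n m
distinct-longer z t n m t≤n distinct i j i<j j<m eq =
  distinct i j i<j j<m (factor-ext z i j t (λ q q<t → factor-pointwise z i j n eq q (<-≤-trans q<t t≤n)))

-- No more than M k factors of length n ≤ LY k + k + 1 are distinct: the factor at M k
-- repeats the factor at 0.
M-maximal : (k n : ℕ) → n ≤ LY k + suc k → (m : ℕ) → DistinctUpTo y n m → m ≤ M k
M-maximal k n n≤ m distinct with m ≤? M k
... | yes m≤M = m≤M
... | no  m≰M = ⊥-elim (distinct 0 (M k) (≤-<-trans z≤n (P<P-suc (lenZ k))) (≰⇒> m≰M)
                         (factor-ext y 0 (M k) n (λ q q<n → sym (y-repeats k q (<-≤-trans q<n n≤)))))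

-- Equal windows of y carry the same block structure

module EqualWindows (i j T : ℕ) (agree : (q : ℕ) → q < T → y (i + q) ≡ y (j + q)) where

  agree-from : (p δ u : ℕ) → p ≡ i + δ → p + u < i + T → y (p + u) ≡ y (j + δ + u)
  agree-from p δ u p≡ p+u< = trans (cong y shift) (trans (agree (δ + u) (+-cancelˡ-< i (δ + u) T (subst (_< i + T) shift p+u<)))
                                                         (cong y (sym (+-assoc j δ u))))
    where
    shift : p + u ≡ i + (δ + u)
    shift = trans (cong (_+ u) p≡) (+-assoc i δ u)

  head-matched : (src δ : ℕ) → P src ≡ i + δ → E src < i + T → Σ ℕ λ tgt → P tgt ≡ j + δ × ruler tgt ≡ ruler src
  head-matched src δ P≡ E< = match (d-position (j + δ) (trans (sym (agree δ δ<T)) (trans (cong y (sym P≡)) (y-P src))))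
    where
    δ<T : δ < T
    δ<T = +-cancelˡ-< i δ T (subst (_< i + T) P≡ (<-trans (P<E src) E<))
    match : (Σ ℕ λ tgt → j + δ ≡ P tgt) → Σ ℕ λ tgt → P tgt ≡ j + δ × ruler tgt ≡ ruler src
    match (tgt , j+δ≡P) = tgt , sym j+δ≡P , sym (same-block-length src tgt λ u u≤ →
      trans (agree-from (P src) δ u P≡ (≤-<-trans (+-monoʳ-≤ (P src) u≤) E<)) (cong (λ p → y (p + u)) j+δ≡P))

  -- A block whose e W d lies in the window is matched by a block of the same length: the
  -- d after the shorter block would face a letter of w in the longer one.
  tail-matched : (src δ : ℕ) → E src ≡ i + δ → P (suc src) < i + T → Σ ℕ λ tgt → E tgt ≡ j + δ × ruler tgt ≡ ruler src
  tail-matched src δ E≡ P< = match (e-position (j + δ) (trans (sym (agree δ δ<T)) (trans (cong y (sym E≡)) (y-E src))))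
    where
    δ<T : δ < T
    δ<T = +-cancelˡ-< i δ T (subst (_< i + T) E≡ (<-trans (E<P-suc src) P<))
    P<' : E src + suc (ruler src) < i + T
    P<' = subst (_< i + T) (P-suc-E src) P<
    y-end : (k : ℕ) → y (E k + suc (ruler k)) ≡ d
    y-end k = trans (cong y (sym (P-suc-E k))) (y-P (suc k))
    match : (Σ ℕ λ tgt → j + δ ≡ E tgt) → Σ ℕ λ tgt → E tgt ≡ j + δ × ruler tgt ≡ ruler src
    match (tgt , j+δ≡E) = tgt , sym j+δ≡E , trichotomy-≡ shorter longer
      where
      agree-E : (u : ℕ) → E src + u < i + T → y (E src + u) ≡ y (E tgt + u)
      agree-E u lt = trans (agree-from (E src) δ u E≡ lt) (cong (λ p → y (p + u)) j+δ≡E)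
      shorter : ¬ (ruler tgt < ruler src)
      shorter lt = w≢d (ruler tgt) (trans (sym (y-W₂ src (ruler tgt) lt))
                     (trans (agree-E (suc (ruler tgt)) (<-trans (+-monoʳ-< (E src) (s≤s lt)) P<')) (y-end tgt)))
      longer : ¬ (ruler src < ruler tgt)
      longer gt = w≢d (ruler src) (trans (sym (y-W₂ tgt (ruler src) gt)) (trans (sym (agree-E (suc (ruler src)) P<')) (y-end src)))

same-distance-to-d : (b₁ b₂ t₁ t₂ T : ℕ) → t₁ < ruler b₁ → t₂ < ruler b₂ → ruler b₁ < T → ruler b₂ < T →
  ((q : ℕ) → q < T → y (E b₁ + suc t₁ + q) ≡ y (E b₂ + suc t₂ + q)) → ruler b₁ + t₂ ≡ ruler b₂ + t₁
same-distance-to-d b₁ b₂ t₁ t₂ T t₁< t₂< x₁<T x₂<T agree with m≤n⇒∃[o]m+o≡n t₁< | m≤n⇒∃[o]m+o≡n t₂<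
... | o₁ , t₁+o₁≡ | o₂ , t₂+o₂≡ =
  trans (cong (_+ t₂) (sym t₁+o₁≡)) (trans (rearrange t₁ t₂ o₁ o₂ (trichotomy-≡ (earlier b₁ b₂ t₁ t₂ o₁ o₂ t₁+o₁≡ t₂+o₂≡ x₁<T agree)
    (earlier b₂ b₁ t₂ t₁ o₂ o₁ t₂+o₂≡ t₁+o₁≡ x₂<T (λ q q<T → sym (agree q q<T))))) (cong (_+ t₁) t₂+o₂≡))
  where
  rearrange : (t₁ t₂ o₁ o₂ : ℕ) → o₁ ≡ o₂ → suc t₁ + o₁ + t₂ ≡ suc t₂ + o₂ + t₁
  rearrange t₁ t₂ o₁ .o₁ refl = swap t₁ t₂ o₁
    where
    swap : (t₁ t₂ o : ℕ) → suc t₁ + o + t₂ ≡ suc t₂ + o + t₁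
    swap = solve-∀
  -- the d closing block b₁, o₁ + 1 letters ahead, would face a letter of w in block b₂
  earlier : (b₁ b₂ t₁ t₂ o₁ o₂ : ℕ) → suc t₁ + o₁ ≡ ruler b₁ → suc t₂ + o₂ ≡ ruler b₂ → ruler b₁ < T →
    ((q : ℕ) → q < T → y (E b₁ + suc t₁ + q) ≡ y (E b₂ + suc t₂ + q)) → ¬ (o₁ < o₂)
  earlier b₁ b₂ t₁ t₂ o₁ o₂ t₁+o₁≡ t₂+o₂≡ x₁<T agree o₁<o₂ =
    w≢d (t₂ + suc o₁) (trans (sym in-W) (trans (sym (agree (suc o₁) q<T)) at-d))
    where
    q<T : suc o₁ < T
    q<T = ≤-<-trans (≤-trans (s≤s (m≤n+m o₁ t₁)) (≤-reflexive t₁+o₁≡)) x₁<T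
    in-W : y (E b₂ + suc t₂ + suc o₁) ≡ w (t₂ + suc o₁)
    in-W = trans (cong y (+-assoc (E b₂) (suc t₂) (suc o₁)))
                 (y-W₂ b₂ (t₂ + suc o₁) (subst (t₂ + suc o₁ <_) t₂+o₂≡ (s≤s (+-monoʳ-≤ t₂ o₁<o₂))))
    at-d : y (E b₁ + suc t₁ + suc o₁) ≡ d
    at-d = trans (cong y (trans (+-assoc (E b₁) (suc t₁) (suc o₁)) (cong (λ k → E b₁ + suc k) (trans (+-suc t₁ o₁) t₁+o₁≡))))
                 (trans (cong y (sym (P-suc-E b₁))) (y-P (suc b₁)))

-- Distinct windows: the first M (K+1) factors of length LY K + K + 2 are distinct (K ≥ 2)

-- The blocks of Z_{K+2} = Z_K K Z_K (K+1) Z_K K Z_K with a value ≥ K, and their positions.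
module LargeBlocks (K : ℕ) where

  L B₁ B₂ B₃ B₄ m T : ℕ
  L  = LY K
  B₁ = lenZ K
  B₂ = lenZ (suc K)
  B₃ = lenZ (suc K) + suc (lenZ K)
  B₄ = lenZ (suc (suc K))
  -- the number of factors shown distinct, and the window length
  m  = M (suc K)
  T  = L + suc (suc K)

  x-B₁ : ruler B₁ ≡ K
  x-B₁ = ruler-lenZ K
  x-B₂ : ruler B₂ ≡ suc K
  x-B₂ = ruler-lenZ (suc K)
  x-B₃ : ruler B₃ ≡ K
  x-B₃ = trans (ruler-shift (suc K) (lenZ K) (lenZ-step K)) x-B₁

  E-B₁ : E B₁ ≡ L + suc K
  E-B₁ = cong (λ x → L + suc x) x-B₁
  P-B₁+1 : P (suc B₁) ≡ L + suc K + suc K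
  P-B₁+1 = trans (P-suc-E B₁) (cong₂ (λ p x → p + suc x) E-B₁ x-B₁)
  P-B₂ : P B₂ ≡ L + suc K + suc K + L
  P-B₂ = trans (LY-suc K) (cong (_+ L) P-B₁+1)
  E-B₂ : E B₂ ≡ L + suc K + suc K + L + suc (suc K)
  E-B₂ = cong₂ (λ p x → p + suc x) P-B₂ x-B₂
  m≡ : m ≡ L + suc K + suc K + L + suc (suc K) + suc (suc K)
  m≡ = trans (P-suc-E B₂) (cong₂ (λ p x → p + suc x) E-B₂ x-B₂)
  P-B₃ : P B₃ ≡ m + L
  P-B₃ = P-shift (suc K) (lenZ K) (≤-trans (n≤1+n _) (lenZ-step K))
  P-B₄ : P B₄ ≡ m + (L + suc K + suc K + L)
  P-B₄ = trans (LY-suc (suc K)) (cong (m +_) P-B₂)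

  B₁<B₂ : B₁ < B₂
  B₁<B₂ = lenZ-step K
  B₂<B₃ : B₂ < B₃
  B₂<B₃ = m<m+n B₂ (s≤s z≤n)

  large-blocks : (p : ℕ) → p < B₄ → K ≤ ruler p → (p ≡ B₁) ⊎ (p ≡ B₂) ⊎ (p ≡ B₃)
  large-blocks p p<B₄ K≤x with <-cmp p B₂
  ... | tri< p<B₂ _ _ = inj₁ (ruler-large-unique K p p<B₂ K≤x)
  ... | tri≈ _ p≡B₂ _ = inj₂ (inj₁ p≡B₂)
  ... | tri> _ _ B₂<p with m≤n⇒∃[o]m+o≡n B₂<p
  ...   | o , refl = inj₂ (inj₂ (trans (sym (+-suc B₂ o)) (cong (λ k → B₂ + suc k)
                      (ruler-large-unique K o o<l (subst (K ≤_) (trans (cong ruler (sym (+-suc B₂ o))) (ruler-shift (suc K) o o<l)) K≤x)))))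
    where
    o<l : o < lenZ (suc K)
    o<l = ≤-pred (+-cancelˡ-< B₂ (suc o) (suc B₂)
            (≤-trans (≤-reflexive (cong suc (+-suc B₂ o))) (≤-trans p<B₄ (≤-reflexive (lenZ-suc (suc K))))))

  large-pair : (p p' : ℕ) → p < p' → p' < B₄ → ruler p ≡ ruler p' → K ≤ ruler p → P p' ≡ P p + m
  large-pair p p' p<p' p'<B₄ same K≤x with large-blocks p (<-trans p<p' p'<B₄) K≤x | large-blocks p' p'<B₄ (subst (K ≤_) same K≤x)
  ... | inj₁ refl        | inj₁ refl        = ⊥-elim (<-irrefl refl p<p')
  ... | inj₁ refl        | inj₂ (inj₁ refl) = ⊥-elim (1+n≢n (trans (sym x-B₂) (trans (sym same) x-B₁)))
  ... | inj₁ refl        | inj₂ (inj₂ refl) = trans P-B₃ (+-comm m L)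
  ... | inj₂ (inj₁ refl) | inj₁ refl        = ⊥-elim (<-asym p<p' B₁<B₂)
  ... | inj₂ (inj₁ refl) | inj₂ (inj₁ refl) = ⊥-elim (<-irrefl refl p<p')
  ... | inj₂ (inj₁ refl) | inj₂ (inj₂ refl) = ⊥-elim (1+n≢n (trans (sym x-B₂) (trans same x-B₃)))
  ... | inj₂ (inj₂ refl) | inj₁ refl        = ⊥-elim (<-asym p<p' (<-trans B₁<B₂ B₂<B₃))
  ... | inj₂ (inj₂ refl) | inj₂ (inj₁ refl) = ⊥-elim (<-asym p<p' B₂<B₃)
  ... | inj₂ (inj₂ refl) | inj₂ (inj₂ refl) = ⊥-elim (<-irrefl refl p<p')

  -- Hence windows at positions i < j < m cannot see the same large block at the same offset.
  no-large-match : (i j : ℕ) → i < j → j < m → (p p' : ℕ) → p < B₄ → p' < B₄ → ruler p ≡ ruler p' →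
                   K ≤ ruler p → P p + j ≡ P p' + i → ⊥
  no-large-match i j i<j j<m p p' p<B₄ p'<B₄ same K≤x aligned with <-cmp p p'
  ... | tri≈ _ refl _ = <-irrefl (+-cancelˡ-≡ (P p) i j (sym aligned)) i<j
  ... | tri< p<p' _ _ = <⇒≱ j<m (≤-by m i (+-cancelˡ-≡ (P p) j (m + i)
          (trans aligned (trans (cong (_+ i) (large-pair p p' p<p' p'<B₄ same K≤x)) (+-assoc (P p) m i)))))
  ... | tri> _ _ p'<p = <⇒≱ i<j (≤-by j m (+-cancelˡ-≡ (P p') i (j + m)
          (trans (sym aligned) (trans (cong (_+ j) (large-pair p' p p'<p p<B₄ (sym same) (subst (K ≤_) same K≤x))) (swap (P p') m j)))))
    where
    swap : (p m j : ℕ) → p + m + j ≡ p + (j + m)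
    swap = solve-∀

-- The argument needs LY K ≥ K + 2, which holds for K ≥ 2.
module DistinctWindows (K r : ℕ) (L≡ : LY K ≡ suc (suc K) + r) where
  open LargeBlocks K

  Large : ℕ → Set
  Large p = (p ≡ B₁) ⊎ (p ≡ B₂)

  -- What a window of length T starting at p < m sees: the d W e or e W d part of a large
  -- block, or it starts in the second W of B₁, at the d of block B₁ + 1, or in the second W of B₂.
  data Start (p : ℕ) : Set where
    sees-head : (bk δ : ℕ) → Large bk → P bk ≡ p + δ → E bk < p + T → Start p
    sees-tail : (bk δ : ℕ) → Large bk → E bk ≡ p + δ → P (suc bk) < p + T → Start p
    in-W₁     : (t : ℕ) → t < K → p ≡ E B₁ + suc t → Start p
    at-d      : p ≡ P (suc B₁) → Start p
    in-W₂     : (t : ℕ) → t < suc K → p ≡ E B₂ + suc t → Start p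

  -- The window length is large enough for the classification.
  E-B₁<T : (p : ℕ) → E B₁ < p + T
  E-B₁<T p = ≤-trans (≤-reflexive (cong suc E-B₁)) (≤-trans (≤-reflexive (shift L K)) (m≤n+m T p))
    where
    shift : (L K : ℕ) → suc (L + suc K) ≡ L + suc (suc K)
    shift = solve-∀

  P-B₁+1<T : (o : ℕ) → P (suc B₁) < (suc L + o) + T
  P-B₁+1<T o = subst (_< (suc L + o) + T) (sym P-B₁+1) (bound L K r o L≡)
    where
    bound : (L K r o : ℕ) → L ≡ suc (suc K) + r → L + suc K + suc K < suc L + o + (L + suc (suc K))
    bound .(suc (suc K) + r) K r o refl = <-by _ (r + o + 2) (ar K r o)
      where
      ar : (K r o : ℕ) → suc (suc (suc K) + r) + o + (suc (suc K) + r + suc (suc K)) ≡ suc (suc (suc K) + r + suc K + suc K) + (r + o + 2)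
      ar = solve-∀

  E-B₂<T : (o : ℕ) → E B₂ < (suc (P (suc B₁)) + o) + T
  E-B₂<T o = subst₂ _<_ (sym E-B₂) (cong (λ p → suc p + o + T) (sym P-B₁+1)) (<-by _ o (ar L K o))
    where
    ar : (L K o : ℕ) → suc (L + suc K + suc K) + o + (L + suc (suc K)) ≡ suc (L + suc K + suc K + L + suc (suc K)) + o
    ar = solve-∀

  m<T : (o : ℕ) → m < (suc (P B₂) + o) + T
  m<T o = subst₂ _<_ (sym (trans m≡ (cong (λ p → p + suc (suc K) + suc (suc K)) (sym P-B₂))))
                     (cong (λ l → suc (P B₂) + o + (l + suc (suc K))) (sym L≡)) (<-by _ (r + o) (ar (P B₂) K r o))
    where
    ar : (X K r o : ℕ) → suc X + o + (suc (suc K) + r + suc (suc K)) ≡ suc (X + suc (suc K) + suc (suc K)) + (r + o)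
    ar = solve-∀

  m+T≤P-B₄ : m + T ≤ P B₄
  m+T≤P-B₄ = subst (m + T ≤_) (sym P-B₄) (+-monoʳ-≤ m (≤-by T (K + L) (ar L K)))
    where
    ar : (L K : ℕ) → L + suc K + suc K + L ≡ L + suc (suc K) + (K + L)
    ar = solve-∀

  offset : (base t x : ℕ) → base + suc t < base + suc x → t < x
  offset base t x lt = ≤-pred (+-cancelˡ-< base (suc t) (suc x) lt)

  classify : (p : ℕ) → p < m → Start p
  classify p p<m with p ≤? P B₁
  ... | yes p≤ with m≤n⇒∃[o]m+o≡n p≤
  ...   | δ , p+δ≡ = sees-head B₁ δ (inj₁ refl) (sym p+δ≡) (E-B₁<T p)
  classify p p<m | no p≰₁ with p ≤? E B₁
  ... | yes p≤ with m≤n⇒∃[o]m+o≡n p≤ | m≤n⇒∃[o]m+o≡n (≰⇒> p≰₁)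
  ...   | δ , p+δ≡ | o , refl = sees-tail B₁ δ (inj₁ refl) (sym p+δ≡) (P-B₁+1<T o)
  classify p p<m | no p≰₁ | no p≰₂ with p <? P (suc B₁)
  ... | yes p< with m≤n⇒∃[o]m+o≡n (≰⇒> p≰₂)
  ...   | t , refl = in-W₁ t (offset (E B₁) t K (subst₂ _<_ (sym (+-suc (E B₁) t)) (trans (P-suc-E B₁) (cong (λ x → E B₁ + suc x) x-B₁)) p<))
                       (sym (+-suc (E B₁) t))
  classify p p<m | no p≰₁ | no p≰₂ | no p≮₃ with p ≟ P (suc B₁)
  ... | yes p≡ = at-d p≡
  ... | no p≢ with p ≤? P B₂
  ...   | yes p≤ with m≤n⇒∃[o]m+o≡n p≤ | m≤n⇒∃[o]m+o≡n (≤∧≢⇒< (≮⇒≥ p≮₃) (≢-sym p≢))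
  ...     | δ , p+δ≡ | o , refl = sees-head B₂ δ (inj₂ refl) (sym p+δ≡) (E-B₂<T o)
  classify p p<m | no p≰₁ | no p≰₂ | no p≮₃ | no p≢ | no p≰₄ with p ≤? E B₂
  ... | yes p≤ with m≤n⇒∃[o]m+o≡n p≤ | m≤n⇒∃[o]m+o≡n (≰⇒> p≰₄)
  ...   | δ , p+δ≡ | o , refl = sees-tail B₂ δ (inj₂ refl) (sym p+δ≡) (m<T o)
  classify p p<m | no p≰₁ | no p≰₂ | no p≮₃ | no p≢ | no p≰₄ | no p≰₅ with m≤n⇒∃[o]m+o≡n (≰⇒> p≰₅)
  ... | t , refl = in-W₂ t (offset (E B₂) t (suc K) (subst₂ _<_ (sym (+-suc (E B₂) t)) (trans (P-suc-E B₂) (cong (λ x → E B₂ + suc x) x-B₂)) p<m))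
                     (sym (+-suc (E B₂) t))

  large<B₄ : {bk : ℕ} → Large bk → bk < B₄
  large<B₄ (inj₁ refl) = <-trans B₁<B₂ (lenZ-step (suc K))
  large<B₄ (inj₂ refl) = lenZ-step (suc K)

  K≤large : {bk : ℕ} → Large bk → K ≤ ruler bk
  K≤large (inj₁ refl) = ≤-reflexive (sym x-B₁)
  K≤large (inj₂ refl) = ≤-trans (n≤1+n K) (≤-reflexive (sym x-B₂))

  -- Windows at p and p' see blocks bk, ck below B₄ with the same large value at the same offset.
  Match : ℕ → ℕ → Set
  Match p p' = Σ ℕ λ bk → Σ ℕ λ ck → bk < B₄ × ck < B₄ × ruler bk ≡ ruler ck × K ≤ ruler bk × P bk + p' ≡ P ck + p

  matched-head : (p p' : ℕ) → ((q : ℕ) → q < T → y (p + q) ≡ y (p' + q)) → p' < m →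
                 (bk δ : ℕ) → Large bk → P bk ≡ p + δ → E bk < p + T → Match p p'
  matched-head p p' agree p'<m bk δ large P≡ E< = match (EqualWindows.head-matched p p' T agree bk δ P≡ E<)
    where
    δ<T : δ < T
    δ<T = +-cancelˡ-< p δ T (subst (_< p + T) P≡ (<-trans (P<E bk) E<))
    swap : (p δ p' : ℕ) → p + δ + p' ≡ p' + δ + p
    swap = solve-∀
    match : (Σ ℕ λ ck → P ck ≡ p' + δ × ruler ck ≡ ruler bk) → Match p p'
    match (ck , P≡' , same) =
      bk , ck , large<B₄ large , P-reflect-< (<-≤-trans (subst (_< m + T) (sym P≡') (+-mono-< p'<m δ<T)) m+T≤P-B₄) ,
      sym same , K≤large large , trans (cong (_+ p') P≡) (trans (swap p δ p') (cong (_+ p) (sym P≡')))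

  matched-tail : (p p' : ℕ) → ((q : ℕ) → q < T → y (p + q) ≡ y (p' + q)) → p' < m →
                 (bk δ : ℕ) → Large bk → E bk ≡ p + δ → P (suc bk) < p + T → Match p p'
  matched-tail p p' agree p'<m bk δ large E≡ P< = match (EqualWindows.tail-matched p p' T agree bk δ E≡ P<)
    where
    δ<T : δ < T
    δ<T = +-cancelˡ-< p δ T (subst (_< p + T) E≡ (<-trans (E<P-suc bk) P<))
    swap : (a b c : ℕ) → a + b + c ≡ a + c + b
    swap = solve-∀
    swap' : (a b c : ℕ) → a + b + c ≡ c + b + a
    swap' = solve-∀
    match : (Σ ℕ λ ck → E ck ≡ p' + δ × ruler ck ≡ ruler bk) → Match p p'
    match (ck , E≡' , same) =
      bk , ck , large<B₄ large ,
      P-reflect-< (<-≤-trans (<-trans (P<E ck) (subst (_< m + T) (sym E≡') (+-mono-< p'<m δ<T))) m+T≤P-B₄) ,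
      sym same , K≤large large , aligned
      where
      -- E bk + p' = E ck + p, and both blocks have the same length
      aligned : P bk + p' ≡ P ck + p
      aligned = +-cancelʳ-≡ (suc (ruler bk)) _ _ (begin
        P bk + p' + suc (ruler bk)       ≡⟨ swap (P bk) p' _ ⟩
        E bk + p'                        ≡⟨ cong (_+ p') E≡ ⟩
        p + δ + p'                       ≡⟨ swap' p δ p' ⟩
        p' + δ + p                       ≡⟨ cong (_+ p) (sym E≡') ⟩
        P ck + suc (ruler ck) + p        ≡⟨ cong (λ x → P ck + suc x + p) same ⟩
        P ck + suc (ruler bk) + p        ≡⟨ sym (swap (P ck) p _) ⟩
        P ck + p + suc (ruler bk)        ∎)
        where open ≡-Reasoning

  x-B₁<T : ruler B₁ < T
  x-B₁<T = subst (_< T) (sym x-B₁) (≤-trans (n≤1+n (suc K)) (m≤n+m (suc (suc K)) L))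
  x-B₂<T : ruler B₂ < T
  x-B₂<T = subst (_< T) (sym x-B₂) (m≤n+m (suc (suc K)) L)

  module TwoWindows (i j : ℕ) (i<j : i < j) (j<m : j < m) (agree : (q : ℕ) → q < T → y (i + q) ≡ y (j + q)) where

    first : y i ≡ y j
    first = trans (cong y (sym (+-identityʳ i))) (trans (agree 0 (≤-trans (s≤s z≤n) (m≤n+m (suc (suc K)) L))) (cong y (+-identityʳ j)))

    agree-at : {i' j' : ℕ} → i ≡ i' → j ≡ j' → (q : ℕ) → q < T → y (i' + q) ≡ y (j' + q)
    agree-at refl refl = agree

    no-match : Match i j → ⊥
    no-match (bk , ck , bk< , ck< , same , K≤ , aligned) = no-large-match i j i<j j<m bk ck bk< ck< same K≤ aligned

    no-match' : Match j i → ⊥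
    no-match' (bk , ck , bk< , ck< , same , K≤ , aligned) =
      no-large-match i j i<j j<m ck bk ck< bk< (sym same) (subst (K ≤_) same K≤) (sym aligned)

    agree' : (q : ℕ) → q < T → y (j + q) ≡ y (i + q)
    agree' q q<T = sym (agree q q<T)

    W≢d : {p : ℕ} (base t : ℕ) → t < ruler base → p ≡ E base + suc t → y p ≢ d
    W≢d base t t< p≡ eq = w≢d t (trans (sym (y-W₂ base t t<)) (trans (cong y (sym p≡)) eq))

    -- Both windows start in the second W of the same block: equally far from its end.
    same-W : (base tᵢ tⱼ : ℕ) → tᵢ < ruler base → tⱼ < ruler base → ruler base < T →
             i ≡ E base + suc tᵢ → j ≡ E base + suc tⱼ → ⊥
    same-W base tᵢ tⱼ tᵢ< tⱼ< x<T i≡ j≡ =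
      <-irrefl (trans i≡ (trans (cong (λ t → E base + suc t) (sym (+-cancelˡ-≡ (ruler base) tⱼ tᵢ dist))) (sym j≡))) i<j
      where
      dist : ruler base + tⱼ ≡ ruler base + tᵢ
      dist = same-distance-to-d base base tᵢ tⱼ T tᵢ< tⱼ< x<T x<T (agree-at i≡ j≡)

    -- The windows start at w(tᵢ) in B₁ and at w(tᵢ + 1) in B₂ with equal letters: a square
    -- of period 1 in w.
    W₁-W₂ : (tᵢ tⱼ : ℕ) → tᵢ < K → tⱼ < suc K → i ≡ E B₁ + suc tᵢ → j ≡ E B₂ + suc tⱼ → ⊥
    W₁-W₂ tᵢ tⱼ tᵢ< tⱼ< i≡ j≡ = w-squarefree tᵢ 1 (s≤s z≤n) λ where
        zero _ → begin
          w (tᵢ + 0)      ≡⟨ cong w (+-identityʳ tᵢ) ⟩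
          w tᵢ            ≡⟨ sym (trans (cong y i≡) (y-W₂ B₁ tᵢ tᵢ<x)) ⟩
          y i             ≡⟨ first ⟩
          y j             ≡⟨ trans (cong y j≡) (y-W₂ B₂ tⱼ tⱼ<x) ⟩
          w tⱼ            ≡⟨ cong w (trans tⱼ≡ (one tᵢ)) ⟩
          w (tᵢ + 1 + 0)  ∎
        (suc k) (s≤s ())
      where
      open ≡-Reasoning
      one : (t : ℕ) → suc t ≡ t + 1 + 0
      one = solve-∀
      tᵢ<x : tᵢ < ruler B₁
      tᵢ<x = subst (tᵢ <_) (sym x-B₁) tᵢ<
      tⱼ<x : tⱼ < ruler B₂
      tⱼ<x = subst (tⱼ <_) (sym x-B₂) tⱼ<
      dist : ruler B₁ + tⱼ ≡ ruler B₂ + tᵢ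
      dist = same-distance-to-d B₁ B₂ tᵢ tⱼ T tᵢ<x tⱼ<x x-B₁<T x-B₂<T (agree-at i≡ j≡)
      tⱼ≡ : tⱼ ≡ suc tᵢ
      tⱼ≡ = +-cancelˡ-≡ K tⱼ (suc tᵢ) (trans (cong (_+ tⱼ) (sym x-B₁)) (trans dist (trans (cong (_+ tᵢ) x-B₂) (sym (+-suc K tᵢ)))))

    -- Block B₂ comes after block B₁.
    W₂-W₁ : (tᵢ tⱼ : ℕ) → tⱼ < K → i ≡ E B₂ + suc tᵢ → j ≡ E B₁ + suc tⱼ → ⊥
    W₂-W₁ tᵢ tⱼ tⱼ< i≡ j≡ = <-asym i<j (subst₂ _<_ (sym j≡) (sym i≡) (<-trans W₁-end W₂-start))
      where
      W₁-end : E B₁ + suc tⱼ < P (suc B₁)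
      W₁-end = subst (E B₁ + suc tⱼ <_) (sym (trans (P-suc-E B₁) (cong (λ x → E B₁ + suc x) x-B₁))) (+-monoʳ-< (E B₁) (s≤s tⱼ<))
      W₂-start : P (suc B₁) < E B₂ + suc tᵢ
      W₂-start = ≤-<-trans (P-mono B₁<B₂) (<-trans (P<E B₂) (m<m+n (E B₂) (s≤s z≤n)))

    compare : Start i → Start j → ⊥
    compare (sees-head bk δ large P≡ E<) _ = no-match (matched-head i j agree j<m bk δ large P≡ E<)
    compare (sees-tail bk δ large E≡ P<) _ = no-match (matched-tail i j agree j<m bk δ large E≡ P<)
    compare _ (sees-head bk δ large P≡ E<) = no-match' (matched-head j i agree' (<-trans i<j j<m) bk δ large P≡ E<)
    compare _ (sees-tail bk δ large E≡ P<) = no-match' (matched-tail j i agree' (<-trans i<j j<m) bk δ large E≡ P<)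
    compare (at-d i≡) (at-d j≡) = <-irrefl (trans i≡ (sym j≡)) i<j
    compare (at-d i≡) (in-W₁ t t< j≡) = W≢d B₁ t (subst (t <_) (sym x-B₁) t<) j≡ (trans (sym first) (trans (cong y i≡) (y-P (suc B₁))))
    compare (at-d i≡) (in-W₂ t t< j≡) = W≢d B₂ t (subst (t <_) (sym x-B₂) t<) j≡ (trans (sym first) (trans (cong y i≡) (y-P (suc B₁))))
    compare (in-W₁ t t< i≡) (at-d j≡) = W≢d B₁ t (subst (t <_) (sym x-B₁) t<) i≡ (trans first (trans (cong y j≡) (y-P (suc B₁))))
    compare (in-W₂ t t< i≡) (at-d j≡) = W≢d B₂ t (subst (t <_) (sym x-B₂) t<) i≡ (trans first (trans (cong y j≡) (y-P (suc B₁))))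
    compare (in-W₁ tᵢ tᵢ< i≡) (in-W₁ tⱼ tⱼ< j≡) =
      same-W B₁ tᵢ tⱼ (subst (tᵢ <_) (sym x-B₁) tᵢ<) (subst (tⱼ <_) (sym x-B₁) tⱼ<) x-B₁<T i≡ j≡
    compare (in-W₂ tᵢ tᵢ< i≡) (in-W₂ tⱼ tⱼ< j≡) =
      same-W B₂ tᵢ tⱼ (subst (tᵢ <_) (sym x-B₂) tᵢ<) (subst (tⱼ <_) (sym x-B₂) tⱼ<) x-B₂<T i≡ j≡
    compare (in-W₁ tᵢ tᵢ< i≡) (in-W₂ tⱼ tⱼ< j≡) = W₁-W₂ tᵢ tⱼ tᵢ< tⱼ< i≡ j≡
    compare (in-W₂ tᵢ _ i≡) (in-W₁ tⱼ tⱼ< j≡) = W₂-W₁ tᵢ tⱼ tⱼ< i≡ j≡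

  distinct : (i j : ℕ) → i < j → j < m → ¬ ((q : ℕ) → q < T → y (i + q) ≡ y (j + q))
  distinct i j i<j j<m agree = TwoWindows.compare i j i<j j<m agree (classify i (<-trans i<j j<m)) (classify j j<m)

-- Distinctness for small windows, by computation

letter-eq : Letter → Letter → Bool
letter-eq a a = true
letter-eq b b = true
letter-eq c c = true
letter-eq d d = true
letter-eq e e = true
letter-eq _ _ = false

word-eq : List Letter → List Letter → Bool
word-eq []       []         = true
word-eq (x ∷ xs) (x' ∷ xs') = letter-eq x x' ∧ word-eq xs xs'
word-eq _        _          = false

letter-eq-refl : (x : Letter) → letter-eq x x ≡ true
letter-eq-refl a = refl
letter-eq-refl b = refl
letter-eq-refl c = refl
letter-eq-refl d = refl
letter-eq-refl e = refl

word-eq-refl : (xs : List Letter) → word-eq xs xs ≡ true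
word-eq-refl []       = refl
word-eq-refl (x ∷ xs) rewrite letter-eq-refl x = word-eq-refl xs

allBelow : (ℕ → Bool) → ℕ → Bool
allBelow p zero    = true
allBelow p (suc k) = allBelow p k ∧ p k

allBelow-sound : (p : ℕ → Bool) (k : ℕ) → allBelow p k ≡ true → (i : ℕ) → i < k → p i ≡ true
allBelow-sound p (suc k) all i i<k with allBelow p k in below | p k in top
allBelow-sound p (suc k) all  i i<k | true  | true with i ≟ k
... | yes refl = top
... | no  i≢k  = allBelow-sound p k below i (≤∧≢⇒< (≤-pred i<k) i≢k)
allBelow-sound p (suc k) () i i<k | true  | false
allBelow-sound p (suc k) () i i<k | false | _

distinct-check : ℕ → ℕ → Bool
distinct-check n m = allBelow (λ j → allBelow (λ i → not (word-eq (factor y i n) (factor y j n))) j) m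

distinct-check-sound : (n m : ℕ) → distinct-check n m ≡ true → DistinctUpTo y n m
distinct-check-sound n m ok i j i<j j<m eq with allBelow-sound _ j (allBelow-sound _ m ok j j<m) i i<j
... | differ rewrite eq | word-eq-refl (factor y j n) = false≢true differ
  where
  false≢true : false ≢ true
  false≢true ()

-- nsc_y(n) = M k on the range tlow k ≤ n ≤ LY k + k + 1

tlow : ℕ → ℕ
tlow zero    = 1
tlow (suc K) = LY K + suc (suc K)

P-1 : P 1 ≡ 2
P-1 = trans (P-suc 0) (cong (_+ 2) P-zero)

P-2 : P 2 ≡ 6
P-2 = trans (P-suc 1) (cong (_+ 4) P-1)

P-4 : P 4 ≡ 14
P-4 = trans (P-suc 3) (cong (_+ 6) (trans (P-suc 2) (cong (_+ 2) P-2)))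

window-range : (n : ℕ) → 1 ≤ n → Σ ℕ λ k → tlow k ≤ n × n ≤ LY k + suc k
window-range (suc zero)    _ = 0 , ≤-refl , m≤n+m 1 (LY 0)
window-range (suc (suc n)) _ with window-range (suc n) (s≤s z≤n)
... | k , lo , hi with suc (suc n) ≤? LY k + suc k
... | yes in-range = k , ≤-trans lo (n≤1+n _) , in-range
... | no  beyond   = suc k , ≤-reflexive next-start ,
  ≤-trans (≤-reflexive (sym next-start)) (+-monoˡ-≤ (suc (suc k)) (≤-trans (m≤n+m (LY k) (M k)) (≤-reflexive (sym (LY-suc k)))))
  where
  next-start : LY k + suc (suc k) ≡ suc (suc n)
  next-start = trans (+-suc (LY k) (suc k)) (cong suc (sym (≤-antisym hi (≤-pred (≰⇒> beyond)))))

distinct-below-M : (k : ℕ) → DistinctUpTo y (tlow k) (M k)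
distinct-below-M zero = subst (DistinctUpTo y 1) (sym P-1) (distinct-check-sound 1 2 refl)
distinct-below-M (suc zero) = subst₂ (DistinctUpTo y) (sym (cong (_+ 2) P-zero)) (sym P-2) (distinct-check-sound 2 6 refl)
distinct-below-M (suc (suc zero)) = subst₂ (DistinctUpTo y) (sym (cong (_+ 3) P-1)) (sym P-4) (distinct-check-sound 5 14 refl)
distinct-below-M (suc (suc (suc K'))) i j i<j j<m eq =
  DistinctWindows.distinct K (proj₁ excess) (sym (proj₂ excess)) i j i<j j<m (factor-pointwise y i j (tlow (suc K)) eq)
  where
  K : ℕ
  K = suc (suc K')
  excess : Σ ℕ λ r → suc (suc K) + r ≡ LY K
  excess = m≤n⇒∃[o]m+o≡n (≤-trans (+-monoˡ-≤ K (s≤s (s≤s z≤n))) (LY-grows K))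

M<3n : (k n : ℕ) → tlow k ≤ n → n ≤ LY k + suc k → n ≢ 2 → M k < 3 * n
M<3n zero n lo _ _ = subst (_< 3 * n) (sym P-1) (≤-trans (s≤s (s≤s (s≤s z≤n))) (*-monoʳ-≤ 3 lo))
M<3n (suc zero) n lo _ n≢2 = subst (_< 3 * n) (sym P-2) (≤-trans (≤-by 7 2 refl) (*-monoʳ-≤ 3 3≤n))
  where
  3≤n : 3 ≤ n
  3≤n = ≤∧≢⇒< (subst (_≤ n) (cong (_+ 2) P-zero) lo) (λ 2≡n → n≢2 (sym 2≡n))
M<3n (suc (suc K')) n lo _ _ =
  subst (_< 3 * n) (sym M-expanded) (<-≤-trans (<-by _ r (ar K r)) (*-monoʳ-≤ 3 (subst (λ l → l + suc (suc K) ≤ n) (sym L≡) lo)))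
  where
  K : ℕ
  K = suc K'
  excess : Σ ℕ λ r → suc K + r ≡ LY K
  excess = m≤n⇒∃[o]m+o≡n (≤-trans (s≤s (s≤s (m≤m+n K' K'))) (≤-trans (≤-reflexive (cong suc (sym (+-suc K' K')))) (LY-grows K)))
  r : ℕ
  r = proj₁ excess
  L≡ : suc K + r ≡ LY K
  L≡ = proj₂ excess
  M-expanded : M (suc K) ≡ (suc K + r) + suc (suc (K + K)) + (suc K + r) + suc (suc (suc K + suc K))
  M-expanded = trans (M≡ (suc K)) (cong (_+ θlen (suc K)) (trans (LY-suc K) (trans (cong (_+ LY K) (M≡ K))
                 (cong₂ (λ l l' → l + θlen K + l') (sym L≡) (sym L≡)))))
  ar : (K r : ℕ) → 3 * ((suc K + r) + suc (suc K)) ≡ suc ((suc K + r) + suc (suc (K + K)) + (suc K + r) + suc (suc (suc K + suc K))) + r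
  ar = solve-∀

mainTheorem15 : SquareFree y
    × ((n : ℕ) → 1 ≤ n → n ≢ 2 → ∃ λ m → IsNsc y n m × m < 3 * n)
mainTheorem15 = y-squarefree , nsc-bound
  where
  nsc-bound : (n : ℕ) → 1 ≤ n → n ≢ 2 → ∃ λ m → IsNsc y n m × m < 3 * n
  nsc-bound n 1≤n n≢2 with window-range n 1≤n
  ... | k , lo , hi = M k , (distinct-longer y (tlow k) n (M k) lo (distinct-below-M k) , M-maximal k n hi) , M<3n k n lo hi n≢2
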